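{- Let $\ell,r$ be positive integers and $w_1,\dots,w_\ell$ nonzero indeterminates. Then $$\det\begin{pmatrix} 1 &w_1 &\cdots & w_1^{\ell-2}& w_1^{ -r} \\ \vdots &\vdots &\ddots & \vdots& \vdots \\ 1 &w_{\ell} &\cdots & w_{\ell}^{\ell-2}& w_{\ell}^{ -r} \end{pmatrix}=\frac{(-1)^{(\ell-1)^2}s_{\mu}(w_1,\dots,w_{\ell})\prod_{1\le j<i\le\ell}(w_i-w_j)}{e_{\ell}(w_1,\dots,w_{\ell})^r},$$ where $\mu=(r-1,r-1,\dots,r-1)$ has $\ell-1$ parts.
   Context: $s_\mu$ is the Schur polynomial in $\ell$ variables and $e_\ell$ the $\ell$-th elementary symmetric polynomial, $e_\ell(w_1,\dots,w_\ell)=w_1\cdots w_\ell$. -}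

module Defs where

open import Algebra.Bundles using (CommutativeRing)
open import Data.Nat using (ℕ; zero; suc; _∸_; _≡ᵇ_; _<ᵇ_; _≤ᵇ_)
open import Data.Fin using (Fin; toℕ; punchIn) renaming (zero to fzero; suc to fsuc)
open import Data.List using (List; []; _∷_; map; foldr; concatMap; concat; replicate; allFin)
open import Data.Bool using (Bool; true; false; if_then_else_; _∧_)

-- all lists of length k with entries in Fin n (entry i stands for the number i+1)
lists : (n k : ℕ) → List (List (Fin n))
lists n zero = [] ∷ []
lists n (suc k) = concatMap (λ a → map (a ∷_) (lists n k)) (allFin n)

fillings : (n : ℕ) → List ℕ → List (List (List (Fin n)))
fillings n [] = [] ∷ []
fillings n (k ∷ ks) = concatMap (λ row → map (row ∷_) (fillings n ks)) (lists n k)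

weakInc : ∀ {n} → List (Fin n) → Bool
weakInc (a ∷ b ∷ xs) = (toℕ a ≤ᵇ toℕ b) ∧ weakInc (b ∷ xs)
weakInc _ = true

colStrict : ∀ {n} → List (Fin n) → List (Fin n) → Bool
colStrict (a ∷ as) (b ∷ bs) = (toℕ a <ᵇ toℕ b) ∧ colStrict as bs
colStrict [] (_ ∷ _) = false
colStrict _ [] = true

isSSYT : ∀ {n} → List (List (Fin n)) → Bool
isSSYT [] = true
isSSYT (r ∷ []) = weakInc r
isSSYT (r ∷ s ∷ rs) = weakInc r ∧ (colStrict r s ∧ isSSYT (s ∷ rs))

module WithRing {c ℓ'} (R : CommutativeRing c ℓ') where
  open CommutativeRing R

  pow : Carrier → ℕ → Carrier
  pow x zero = 1#
  pow x (suc n) = x * pow x n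

  sumL : List Carrier → Carrier
  sumL = foldr _+_ 0#

  prodL : List Carrier → Carrier
  prodL = foldr _*_ 1#

  sign : ℕ → Carrier
  sign n = pow (- 1#) n

  det : (n : ℕ) → (Fin n → Fin n → Carrier) → Carrier
  det zero M = 1#
  det (suc n) M =
    sumL (map (λ j → sign (toℕ j) * (M fzero j * det n (λ i k → M (fsuc i) (punchIn j k))))
              (allFin (suc n)))

  schur : (n : ℕ) → List ℕ → (Fin n → Carrier) → Carrier
  schur n λs x =
    sumL (map (λ T → if isSSYT T then prodL (map x (concat T)) else 0#) (fillings n λs))

  elem : (n : ℕ) → (Fin n → Carrier) → Carrier
  elem n x = prodL (map x (allFin n))

  vandermonde : (n : ℕ) → (Fin n → Carrier) → Carrier
  vandermonde n x =
    prodL (concatMap (λ i → concatMap (λ j → if toℕ j <ᵇ toℕ i then (x i - x j) ∷ [] else [])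
                                       (allFin n))
                     (allFin n))

  -- the ℓ×ℓ matrix with row i = (1, w_i, …, w_i^{ℓ-2}, w_i^{-r}), where winv i = w_i^{-1}
  lemMatrix : (ℓ r : ℕ) → (w winv : Fin ℓ → Carrier) → Fin ℓ → Fin ℓ → Carrier
  lemMatrix ℓ r w winv i j =
    if toℕ j ≡ᵇ (ℓ ∸ 1) then pow (winv i) r else pow (w i) (toℕ j)

{-# OPTIONS --safe #-}
module Submission where

-- Write z = winv, so zᵢ = wᵢ⁻¹, and let h_k be the complete homogeneous symmetric polynomial.
--
-- Subtracting z₀^r times the first column from the last one, and then w₀Cⱼ from each power
-- column Cⱼ₊₁, turns the first row into (1, 0, …, 0).  Because wᵢzᵢ = 1,
-- zᵢ^r − z₀^r = (wᵢ − w₀)·(−z₀)·Σ_{a<r} z₀^(r−1−a) zᵢ^(a+1), so each remaining row i carries the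
-- factor wᵢ − w₀ and the minor is a combination of determinants of the same shape in one variable
-- fewer.  Induction gives det = (−1)^(ℓ−1) Δ(w) e_ℓ(z) h_{r−1}(z) with Δ(w) = ∏_{j<i} (wᵢ − wⱼ).
--
-- A semistandard tableau of rectangular shape μ with entries in [ℓ] is a sequence of r − 1
-- columns, each of them [ℓ] with one entry q left out, and its weight is e_ℓ(w)·z_q; the rows
-- weakly increase exactly when the omitted entries weakly decrease.  Hence
-- s_μ(w)·e_ℓ(z)^(r−1) = h_{r−1}(z), and (−1)^((ℓ−1)²) = (−1)^(ℓ−1).

open import Algebra.Bundles using (CommutativeRing; RawRing)
import Algebra.Solver.Ring as RingSolver
open import Algebra.Solver.Ring.AlmostCommutativeRing using (fromCommutativeRing; _-Raw-AlmostCommutative⟶_)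
open import Data.Bool using (Bool; true; false; T; _∧_; if_then_else_)
import Data.Bool.Properties as Bool
open import Data.Bool.Solver using (module ∨-∧-Solver)
open import Data.Fin as Fin using (Fin; zero; suc; toℕ; inject₁; punchIn; punchOut; fromℕ; fromℕ<)
import Data.Fin.Properties as Fin
open import Data.Integer as ℤ using (ℤ; +_; -[1+_]; _⊖_; _◃_; ∣_∣)
import Data.Integer.Properties as ℤ
open import Data.List as List using (List; []; _∷_; _++_; map; concat; concatMap; replicate; tabulate; length; allFin)
import Data.List.Properties as List
open import Data.Maybe using (Maybe; just; nothing)
open import Data.Nat as ℕ using (ℕ; zero; suc; z≤n; s≤s; _≤_; _∸_; _≤ᵇ_; _<ᵇ_; _≡ᵇ_)
import Data.Nat.Properties as ℕ
open import Data.Sign as Sign using (Sign)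
open import Data.Unit using (tt)
open import Data.Vec.Functional as Vector using (updateAt)
open import Data.Vec.Functional.Properties using (updateAt-updates; updateAt-minimal)
open import Function using (_∘_; id; const)
open import Function.Bundles using (Equivalence)
open import Relation.Binary.Definitions using (tri<; tri≈; tri>)
open import Relation.Binary.PropositionalEquality as ≡ using (_≡_; _≢_)
open import Relation.Nullary using (¬_; yes; no; contradiction)
open import Defs

module IntegerCoefficients {c ℓ'} (R : CommutativeRing c ℓ') where
  open CommutativeRing R hiding (zero)
  open import Algebra.Properties.Ring ring using (-1*x≈-x; -‿involutive; -0#≈0#; -‿+-comm)
  open import Algebra.Properties.Semiring.Mult.TCOptimised semiring using (_×_; 1+×; ×-homo-+; ×1-homo-*)
  open import Algebra.Properties.CommutativeSemigroup *-commutativeSemigroup using (interchange)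
  open import Relation.Binary.Reasoning.Setoid setoid

  ⟦_⟧ˢ : Sign → Carrier
  ⟦ Sign.+ ⟧ˢ = 1#
  ⟦ Sign.- ⟧ˢ = - 1#

  -- the type-checking-optimised _×_ makes ⟦ + 1 ⟧ reduce to 1#, which solve … refl relies on
  ⟦_⟧ : ℤ → Carrier
  ⟦ + n ⟧ = n × 1#
  ⟦ -[1+ n ] ⟧ = - (suc n × 1#)

  ⟦⟧ˢ-homo-* : ∀ s t → ⟦ s Sign.* t ⟧ˢ ≈ ⟦ s ⟧ˢ * ⟦ t ⟧ˢ
  ⟦⟧ˢ-homo-* Sign.+ t = sym (*-identityˡ _)
  ⟦⟧ˢ-homo-* Sign.- Sign.+ = sym (*-identityʳ _)
  ⟦⟧ˢ-homo-* Sign.- Sign.- = sym (trans (-1*x≈-x _) (-‿involutive _))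

  ⟦⟧-◃ : ∀ s n → ⟦ s ◃ n ⟧ ≈ ⟦ s ⟧ˢ * (n × 1#)
  ⟦⟧-◃ s zero = sym (zeroʳ _)
  ⟦⟧-◃ Sign.+ (suc n) = sym (*-identityˡ _)
  ⟦⟧-◃ Sign.- (suc n) = sym (-1*x≈-x _)

  ⟦⟧-homo-* : ∀ i j → ⟦ i ℤ.* j ⟧ ≈ ⟦ i ⟧ * ⟦ j ⟧
  ⟦⟧-homo-* i j = begin
    ⟦ i ℤ.* j ⟧
      ≈⟨ ⟦⟧-◃ (ℤ.sign i Sign.* ℤ.sign j) (∣ i ∣ ℕ.* ∣ j ∣) ⟩
    ⟦ ℤ.sign i Sign.* ℤ.sign j ⟧ˢ * ((∣ i ∣ ℕ.* ∣ j ∣) × 1#)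
      ≈⟨ *-cong (⟦⟧ˢ-homo-* (ℤ.sign i) (ℤ.sign j)) (×1-homo-* ∣ i ∣ ∣ j ∣) ⟩
    (⟦ ℤ.sign i ⟧ˢ * ⟦ ℤ.sign j ⟧ˢ) * (⟦ + ∣ i ∣ ⟧ * ⟦ + ∣ j ∣ ⟧)
      ≈⟨ interchange _ _ _ _ ⟩
    (⟦ ℤ.sign i ⟧ˢ * ⟦ + ∣ i ∣ ⟧) * (⟦ ℤ.sign j ⟧ˢ * ⟦ + ∣ j ∣ ⟧)
      ≈⟨ *-cong (signed-abs i) (signed-abs j) ⟩
    ⟦ i ⟧ * ⟦ j ⟧                                          ∎
    where
    signed-abs : ∀ k → ⟦ ℤ.sign k ⟧ˢ * ⟦ + ∣ k ∣ ⟧ ≈ ⟦ k ⟧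
    signed-abs k = trans (sym (⟦⟧-◃ (ℤ.sign k) ∣ k ∣)) (reflexive (≡.cong ⟦_⟧ (ℤ.◃-inverse k)))

  ⟦⟧-⊖ : ∀ m n → ⟦ m ⊖ n ⟧ ≈ m × 1# - n × 1#
  ⟦⟧-⊖ zero zero = sym (-‿inverseʳ 0#)
  ⟦⟧-⊖ (suc m) zero = sym (trans (+-congˡ -0#≈0#) (+-identityʳ _))
  ⟦⟧-⊖ zero (suc n) = sym (+-identityˡ _)
  ⟦⟧-⊖ (suc m) (suc n) = begin
    ⟦ suc m ⊖ suc n ⟧               ≡⟨ ≡.cong ⟦_⟧ (ℤ.[1+m]⊖[1+n]≡m⊖n m n) ⟩
    ⟦ m ⊖ n ⟧                       ≈⟨ ⟦⟧-⊖ m n ⟩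
    a - b                           ≈⟨ +-congˡ (+-identityˡ (- b)) ⟨
    a + (0# - b)                    ≈⟨ +-congˡ (+-congʳ (-‿inverseʳ 1#)) ⟨
    a + ((1# - 1#) - b)             ≈⟨ +-congˡ (+-assoc 1# (- 1#) (- b)) ⟩
    a + (1# + (- 1# - b))           ≈⟨ +-assoc a 1# _ ⟨
    (a + 1#) + (- 1# - b)           ≈⟨ +-cong (+-comm a 1#) (-‿+-comm 1# b) ⟩
    (1# + a) - (1# + b)             ≈⟨ +-cong (1+× m 1#) (-‿cong (1+× n 1#)) ⟨
    suc m × 1# - suc n × 1#         ∎
    where
    a = m × 1#
    b = n × 1#

  ⟦⟧-homo-+ : ∀ i j → ⟦ i ℤ.+ j ⟧ ≈ ⟦ i ⟧ + ⟦ j ⟧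
  ⟦⟧-homo-+ (+ m) (+ n) = ×-homo-+ 1# m n
  ⟦⟧-homo-+ (+ m) -[1+ n ] = ⟦⟧-⊖ m (suc n)
  ⟦⟧-homo-+ -[1+ m ] (+ n) = trans (⟦⟧-⊖ n (suc m)) (+-comm _ _)
  ⟦⟧-homo-+ -[1+ m ] -[1+ n ] = begin
    - (suc (suc (m ℕ.+ n)) × 1#)         ≡⟨ ≡.cong (λ k → - (suc k × 1#)) (≡.sym (ℕ.+-suc m n)) ⟩
    - ((suc m ℕ.+ suc n) × 1#)           ≈⟨ -‿cong (×-homo-+ 1# (suc m) (suc n)) ⟩
    - (suc m × 1# + suc n × 1#)          ≈⟨ sym (-‿+-comm _ _) ⟩
    - (suc m × 1#) + - (suc n × 1#)      ∎

  ⟦⟧-homo-neg : ∀ i → ⟦ ℤ.- i ⟧ ≈ - ⟦ i ⟧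
  ⟦⟧-homo-neg (+ zero) = sym -0#≈0#
  ⟦⟧-homo-neg (+ suc n) = refl
  ⟦⟧-homo-neg -[1+ n ] = sym (-‿involutive _)

  ℤ-rawRing : RawRing _ _
  ℤ-rawRing = record
    { Carrier = ℤ ; _≈_ = _≡_ ; _+_ = ℤ._+_ ; _*_ = ℤ._*_ ; -_ = ℤ.-_ ; 0# = + 0 ; 1# = + 1 }

  ⟦⟧-homomorphism : ℤ-rawRing -Raw-AlmostCommutative⟶ fromCommutativeRing R
  ⟦⟧-homomorphism = record
    { ⟦_⟧ = ⟦_⟧ ; +-homo = ⟦⟧-homo-+ ; *-homo = ⟦⟧-homo-* ; -‿homo = ⟦⟧-homo-neg
    ; 0-homo = refl ; 1-homo = refl }

  ⟦_⟧≟⟦_⟧ : ∀ i j → Maybe (⟦ i ⟧ ≈ ⟦ j ⟧)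
  ⟦ i ⟧≟⟦ j ⟧ with i ℤ.≟ j
  ... | yes ≡.refl = just refl
  ... | no _ = nothing

  open RingSolver ℤ-rawRing (fromCommutativeRing R) ⟦⟧-homomorphism ⟦_⟧≟⟦_⟧ public
    using (solve; _:+_; _:*_; _:-_; :-_; _:=_; con)

module Powers {c ℓ'} (R : CommutativeRing c ℓ') where
  open CommutativeRing R hiding (zero)
  open WithRing R
  open IntegerCoefficients R
  open import Relation.Binary.Reasoning.Setoid setoid

  pow-cong : ∀ {x y} → x ≈ y → ∀ s → pow x s ≈ pow y s
  pow-cong x≈y zero = refl
  pow-cong x≈y (suc s) = *-cong x≈y (pow-cong x≈y s)

  pow-+ : ∀ x m n → pow x (m ℕ.+ n) ≈ pow x m * pow x n
  pow-+ x zero n = sym (*-identityˡ _)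
  pow-+ x (suc m) n = trans (*-congˡ (pow-+ x m n)) (sym (*-assoc _ _ _))

  sign-*-sign : ∀ n → sign n * sign n ≈ 1#
  sign-*-sign zero = *-identityˡ 1#
  sign-*-sign (suc n) = trans (solve 1 (λ σ → (:- con (+ 1) :* σ) :* (:- con (+ 1) :* σ) := σ :* σ) refl (sign n)) (sign-*-sign n)

  sign-square : ∀ n → sign (n ℕ.* n) ≈ sign n
  sign-square zero = refl
  sign-square (suc n) = begin
    - 1# * sign (n ℕ.+ n ℕ.* suc n)
      ≡⟨ ≡.cong (λ k → - 1# * sign (n ℕ.+ k)) (ℕ.*-suc n n) ⟩
    - 1# * sign (n ℕ.+ (n ℕ.+ n ℕ.* n))
      ≈⟨ *-congˡ (trans (pow-+ (- 1#) n _) (*-congˡ (pow-+ (- 1#) n (n ℕ.* n)))) ⟩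
    - 1# * (sign n * (sign n * sign (n ℕ.* n)))
      ≈⟨ *-congˡ (trans (sym (*-assoc _ _ _)) (*-congʳ (sign-*-sign n))) ⟩
    - 1# * (1# * sign (n ℕ.* n))
      ≈⟨ *-congˡ (trans (*-identityˡ _) (sign-square n)) ⟩
    - 1# * sign n                                 ∎

module Summation {c ℓ'} (R : CommutativeRing c ℓ') where
  open CommutativeRing R hiding (zero)
  open WithRing R
  open IntegerCoefficients R
  open import Algebra.Properties.Ring ring using (-0#≈0#; -‿+-comm)
  open import Relation.Binary.Reasoning.Setoid setoid
  open import Algebra.Properties.Semiring.Sum semiring public
    using (sum; sum-cong-≋; sum-replicate-zero; ∑-distrib-+; *-distribˡ-sum; *-distribʳ-sum)
  open import Algebra.Properties.CommutativeMonoid.Sum *-commutativeMonoid public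
    using () renaming (sum to prod; ∑-distrib-+ to ∏-distrib-*; sum-remove to prod-remove)

  foldr-tabulate : ∀ {a b} {A : Set a} {B : Set b} (_∙_ : A → B → B) (e : B) {n} (f : Fin n → A) →
    List.foldr _∙_ e (tabulate f) ≡ Vector.foldr _∙_ e f
  foldr-tabulate _∙_ e {zero} f = ≡.refl
  foldr-tabulate _∙_ e {suc n} f = ≡.cong (f zero ∙_) (foldr-tabulate _∙_ e (f ∘ suc))

  sumL-allFin : ∀ {n} (f : Fin n → Carrier) → sumL (map f (allFin n)) ≡ sum f
  sumL-allFin {n} f = ≡.trans (≡.cong sumL (List.map-tabulate id f)) (foldr-tabulate _+_ 0# f)

  prodL-allFin : ∀ {n} (f : Fin n → Carrier) → prodL (map f (allFin n)) ≡ prod f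
  prodL-allFin {n} f = ≡.trans (≡.cong prodL (List.map-tabulate id f)) (foldr-tabulate _*_ 1# f)

  sum-zero : ∀ {n} (f : Fin n → Carrier) → (∀ i → f i ≈ 0#) → sum f ≈ 0#
  sum-zero {n} f f≈0 = trans (sum-cong-≋ f≈0) (sum-replicate-zero n)

  prod-one : ∀ {n} (f : Fin n → Carrier) → (∀ i → f i ≈ 1#) → prod f ≈ 1#
  prod-one {zero} f f≈1 = refl
  prod-one {suc n} f f≈1 = trans (*-cong (f≈1 zero) (prod-one (f ∘ suc) (f≈1 ∘ suc))) (*-identityˡ 1#)

  sum-neg : ∀ {n} (f : Fin n → Carrier) → sum (λ i → - f i) ≈ - sum f
  sum-neg {zero} f = sym -0#≈0#
  sum-neg {suc n} f = trans (+-congˡ (sum-neg (f ∘ suc))) (-‿+-comm _ _)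

  sum-linear : ∀ {n} a b {f g h : Fin n → Carrier} → (∀ i → f i ≈ a * g i + b * h i) →
    sum f ≈ a * sum g + b * sum h
  sum-linear a b {f} {g} {h} f≈ag+bh = begin
    sum f                                      ≈⟨ sum-cong-≋ f≈ag+bh ⟩
    sum (λ i → a * g i + b * h i)              ≈⟨ ∑-distrib-+ (λ i → a * g i) (λ i → b * h i) ⟩
    sum (λ i → a * g i) + sum (λ i → b * h i)  ≈⟨ +-cong (*-distribˡ-sum a g) (*-distribˡ-sum b h) ⟨
    a * sum g + b * sum h                      ∎

  prodL-++ : (xs ys : List Carrier) → prodL (xs ++ ys) ≈ prodL xs * prodL ys
  prodL-++ [] ys = sym (*-identityˡ _)
  prodL-++ (x ∷ xs) ys = trans (*-congˡ (prodL-++ xs ys)) (sym (*-assoc _ _ _))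

  prodL-concatMap : ∀ {a} {A : Set a} (g : A → List Carrier) (xs : List A) → prodL (concatMap g xs) ≈ prodL (map (prodL ∘ g) xs)
  prodL-concatMap g [] = refl
  prodL-concatMap g (x ∷ xs) = trans (prodL-++ (g x) (concatMap g xs)) (*-congˡ (prodL-concatMap g xs))

  prodL-map-cong : ∀ {a} {A : Set a} (xs : List A) {f g : A → Carrier} → (∀ x → f x ≈ g x) → prodL (map f xs) ≈ prodL (map g xs)
  prodL-map-cong [] f≈g = refl
  prodL-map-cong (x ∷ xs) f≈g = *-cong (f≈g x) (prodL-map-cong xs f≈g)

  sumOver : ∀ {a} {A : Set a} → List A → (A → Carrier) → Carrier
  sumOver xs f = sumL (map f xs)

  sumOver-cong : ∀ {a} {A : Set a} (xs : List A) {f g : A → Carrier} → (∀ x → f x ≈ g x) → sumOver xs f ≈ sumOver xs g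
  sumOver-cong [] f≈g = refl
  sumOver-cong (x ∷ xs) f≈g = +-cong (f≈g x) (sumOver-cong xs f≈g)

  sumOver-++ : ∀ {a} {A : Set a} (xs ys : List A) (f : A → Carrier) → sumOver (xs ++ ys) f ≈ sumOver xs f + sumOver ys f
  sumOver-++ [] ys f = sym (+-identityˡ _)
  sumOver-++ (x ∷ xs) ys f = trans (+-congˡ (sumOver-++ xs ys f)) (sym (+-assoc _ _ _))

  sumOver-concatMap : ∀ {a b} {A : Set a} {B : Set b} (g : A → List B) (xs : List A) (f : B → Carrier) →
    sumOver (concatMap g xs) f ≈ sumOver xs (λ x → sumOver (g x) f)
  sumOver-concatMap g [] f = refl
  sumOver-concatMap g (x ∷ xs) f = trans (sumOver-++ (g x) (concatMap g xs) f) (+-congˡ (sumOver-concatMap g xs f))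

  sumOver-map : ∀ {a b} {A : Set a} {B : Set b} (g : A → B) (xs : List A) (f : B → Carrier) →
    sumOver (map g xs) f ≡ sumOver xs (f ∘ g)
  sumOver-map g xs f = ≡.cong sumL (≡.sym (List.map-∘ xs))

  *-distribˡ-sumOver : ∀ {a} {A : Set a} x (ys : List A) (f : A → Carrier) → x * sumOver ys f ≈ sumOver ys (λ y → x * f y)
  *-distribˡ-sumOver x [] f = zeroʳ x
  *-distribˡ-sumOver x (y ∷ ys) f = trans (distribˡ _ _ _) (+-congˡ (*-distribˡ-sumOver x ys f))

  sumOver-zero : ∀ {a} {A : Set a} (xs : List A) {f : A → Carrier} → (∀ x → f x ≈ 0#) → sumOver xs f ≈ 0#
  sumOver-zero [] f≈0 = refl
  sumOver-zero (x ∷ xs) f≈0 = trans (+-cong (f≈0 x) (sumOver-zero xs f≈0)) (+-identityˡ 0#)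

  sumOver-distrib-+ : ∀ {a} {A : Set a} (xs : List A) (f g : A → Carrier) →
    sumOver xs (λ x → f x + g x) ≈ sumOver xs f + sumOver xs g
  sumOver-distrib-+ [] f g = sym (+-identityˡ 0#)
  sumOver-distrib-+ (x ∷ xs) f g = trans (+-congˡ (sumOver-distrib-+ xs f g))
    (solve 4 (λ a b c d → (a :+ b) :+ (c :+ d) := (a :+ c) :+ (b :+ d)) refl _ _ _ _)

  sumOver-comm : ∀ {a b} {A : Set a} {B : Set b} (xs : List A) (ys : List B) (f : A → B → Carrier) →
    sumOver xs (λ x → sumOver ys (f x)) ≈ sumOver ys (λ y → sumOver xs (λ x → f x y))
  sumOver-comm [] ys f = sym (sumOver-zero ys (λ _ → refl))
  sumOver-comm (x ∷ xs) ys f = trans (+-congˡ (sumOver-comm xs ys f)) (sym (sumOver-distrib-+ ys (f x) _))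

  sumOver-if : ∀ {a} {A : Set a} (xs : List A) b (f : A → Carrier) →
    sumOver xs (λ x → if b then f x else 0#) ≈ (if b then sumOver xs f else 0#)
  sumOver-if xs true f = refl
  sumOver-if xs false f = sumOver-zero xs (λ _ → refl)

module Determinant {c ℓ'} (R : CommutativeRing c ℓ') where
  open CommutativeRing R hiding (zero)
  open WithRing R
  open IntegerCoefficients R
  open Summation R
  open import Algebra.Properties.Ring ring using (-‿involutive; -0#≈0#)
  open import Relation.Binary.Reasoning.Setoid setoid

  Matrix : ℕ → Set c
  Matrix n = Fin n → Fin n → Carrier

  minor : ∀ {n} → Matrix (suc n) → Fin (suc n) → Matrix n
  minor M j i k = M (suc i) (punchIn j k)

  laplaceTerm : ∀ {n} → Matrix (suc n) → Fin (suc n) → Carrier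
  laplaceTerm {n} M j = sign (toℕ j) * (M zero j * det n (minor M j))

  det-laplace : ∀ {n} (M : Matrix (suc n)) → det (suc n) M ≡ sum (laplaceTerm M)
  det-laplace M = sumL-allFin (laplaceTerm M)

  entry-≡ : ∀ {n} (M : Matrix n) i {j k} → j ≡ k → M i j ≈ M i k
  entry-≡ M i j≡k = reflexive (≡.cong (M i) j≡k)

  det-cong : ∀ {n} {M N : Matrix n} → (∀ i j → M i j ≈ N i j) → det n M ≈ det n N
  det-cong {zero} M≈N = refl
  det-cong {suc n} {M} {N} M≈N = begin
    det (suc n) M        ≡⟨ det-laplace M ⟩
    sum (laplaceTerm M)  ≈⟨ sum-cong-≋ term-cong ⟩
    sum (laplaceTerm N)  ≡⟨ det-laplace N ⟨
    det (suc n) N        ∎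
    where
    term-cong : ∀ j → laplaceTerm M j ≈ laplaceTerm N j
    term-cong j = *-congˡ (*-cong (M≈N zero j) (det-cong (λ i k → M≈N (suc i) (punchIn j k))))

  punchIn≢ : ∀ {n} {m k : Fin (suc n)} (m≢k : m ≢ k) {j : Fin n} → j ≢ punchOut m≢k → punchIn m j ≢ k
  punchIn≢ {m = m} m≢k {j} j≢k′ eq =
    j≢k′ (Fin.punchIn-injective m j _ (≡.trans eq (≡.sym (Fin.punchIn-punchOut m≢k))))

  det-linear : ∀ {n} (k : Fin n) a b {M M₁ M₂ : Matrix n} →
    (∀ i j → j ≢ k → M₁ i j ≈ M i j) → (∀ i j → j ≢ k → M₂ i j ≈ M i j) →
    (∀ i → M i k ≈ a * M₁ i k + b * M₂ i k) →
    det n M ≈ a * det n M₁ + b * det n M₂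

  laplaceTerm-linear : ∀ {n} (k : Fin (suc n)) a b {M M₁ M₂ : Matrix (suc n)} →
    (∀ i j → j ≢ k → M₁ i j ≈ M i j) → (∀ i j → j ≢ k → M₂ i j ≈ M i j) →
    (∀ i → M i k ≈ a * M₁ i k + b * M₂ i k) →
    ∀ m → laplaceTerm M m ≈ a * laplaceTerm M₁ m + b * laplaceTerm M₂ m

  det-linear {suc n} k a b {M} {M₁} {M₂} M₁≈M M₂≈M Mₖ = begin
    det (suc n) M                                        ≡⟨ det-laplace M ⟩
    sum (laplaceTerm M)                                  ≈⟨ sum-linear a b (laplaceTerm-linear k a b M₁≈M M₂≈M Mₖ) ⟩
    a * sum (laplaceTerm M₁) + b * sum (laplaceTerm M₂)  ≡⟨ ≡.cong₂ (λ d₁ d₂ → a * d₁ + b * d₂) (det-laplace M₁) (det-laplace M₂) ⟨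
    a * det (suc n) M₁ + b * det (suc n) M₂              ∎

  laplaceTerm-linear {n} k a b {M} {M₁} {M₂} M₁≈M M₂≈M Mₖ m with m Fin.≟ k
  ... | yes ≡.refl = begin
    s * (M zero m * D)                                     ≈⟨ *-congˡ (*-congʳ (Mₖ zero)) ⟩
    s * ((a * M₁ zero m + b * M₂ zero m) * D)              ≈⟨ distribute s a b _ _ D ⟩
    a * (s * (M₁ zero m * D)) + b * (s * (M₂ zero m * D))  ≈⟨ +-cong (scaled (same-minor M₁≈M)) (scaled (same-minor M₂≈M)) ⟨
    a * laplaceTerm M₁ m + b * laplaceTerm M₂ m            ∎
    where
    s = sign (toℕ m)
    D = det n (minor M m)
    same-minor : ∀ {N} → (∀ i j → j ≢ m → N i j ≈ M i j) → det n (minor N m) ≈ D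
    same-minor N≈M = det-cong (λ i j → N≈M (suc i) (punchIn m j) (Fin.punchInᵢ≢i m j))
    scaled : ∀ {c x D′} → D′ ≈ D → c * (s * (x * D′)) ≈ c * (s * (x * D))
    scaled D′≈D = *-congˡ (*-congˡ (*-congˡ D′≈D))
    distribute : ∀ s a b x y d → s * ((a * x + b * y) * d) ≈ a * (s * (x * d)) + b * (s * (y * d))
    distribute = solve 6 (λ s a b x y d → s :* ((a :* x :+ b :* y) :* d) := a :* (s :* (x :* d)) :+ b :* (s :* (y :* d))) refl
  ... | no m≢k = begin
    s * (M zero m * D)                                     ≈⟨ *-congˡ (*-congˡ minor-linear) ⟩
    s * (M zero m * (a * D₁ + b * D₂))                     ≈⟨ distribute s a b _ D₁ D₂ ⟩
    a * (s * (M zero m * D₁)) + b * (s * (M zero m * D₂))  ≈⟨ +-cong (scaled (M₁≈M zero m m≢k)) (scaled (M₂≈M zero m m≢k)) ⟨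
    a * laplaceTerm M₁ m + b * laplaceTerm M₂ m            ∎
    where
    s = sign (toℕ m)
    D = det n (minor M m)
    D₁ = det n (minor M₁ m)
    D₂ = det n (minor M₂ m)
    minor-linear : D ≈ a * D₁ + b * D₂
    minor-linear = det-linear (punchOut m≢k) a b
      (λ i j j≢k′ → M₁≈M (suc i) (punchIn m j) (punchIn≢ m≢k j≢k′))
      (λ i j j≢k′ → M₂≈M (suc i) (punchIn m j) (punchIn≢ m≢k j≢k′))
      (λ i → ≡.subst (λ l → M (suc i) l ≈ a * M₁ (suc i) l + b * M₂ (suc i) l) (≡.sym (Fin.punchIn-punchOut m≢k)) (Mₖ (suc i)))
    scaled : ∀ {c x′ D′} → x′ ≈ M zero m → c * (s * (x′ * D′)) ≈ c * (s * (M zero m * D′))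
    scaled x′≈x = *-congˡ (*-congˡ (*-congʳ x′≈x))
    distribute : ∀ s a b x d e → s * (x * (a * d + b * e)) ≈ a * (s * (x * d)) + b * (s * (x * e))
    distribute = solve 6 (λ s a b x d e → s :* (x :* (a :* d :+ b :* e)) := a :* (s :* (x :* d)) :+ b :* (s :* (x :* e))) refl

  swap : ∀ {n} → Fin n → Fin (suc n) → Fin (suc n)
  swap {suc n} zero zero = suc zero
  swap {suc n} zero (suc zero) = zero
  swap {suc n} zero (suc (suc k)) = suc (suc k)
  swap {suc n} (suc c) zero = zero
  swap {suc n} (suc c) (suc k) = suc (swap c k)

  swap-inject₁ : ∀ {n} (c : Fin n) → swap c (inject₁ c) ≡ suc c
  swap-inject₁ zero = ≡.refl
  swap-inject₁ (suc c) = ≡.cong suc (swap-inject₁ c)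

  swap-suc : ∀ {n} (c : Fin n) → swap c (suc c) ≡ inject₁ c
  swap-suc zero = ≡.refl
  swap-suc (suc c) = ≡.cong suc (swap-suc c)

  swap-punchIn-inject₁ : ∀ {n} (c : Fin n) k → swap c (punchIn (inject₁ c) k) ≡ punchIn (suc c) k
  swap-punchIn-inject₁ zero zero = ≡.refl
  swap-punchIn-inject₁ zero (suc k) = ≡.refl
  swap-punchIn-inject₁ (suc c) zero = ≡.refl
  swap-punchIn-inject₁ (suc c) (suc k) = ≡.cong suc (swap-punchIn-inject₁ c k)

  swap-punchIn-suc : ∀ {n} (c : Fin n) k → swap c (punchIn (suc c) k) ≡ punchIn (inject₁ c) k
  swap-punchIn-suc zero zero = ≡.refl
  swap-punchIn-suc zero (suc k) = ≡.refl
  swap-punchIn-suc (suc c) zero = ≡.refl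
  swap-punchIn-suc (suc c) (suc k) = ≡.cong suc (swap-punchIn-suc c k)

  swap-< : ∀ {n} (c : Fin n) (j : Fin (suc n)) → toℕ j ℕ.< toℕ c → swap c j ≡ j
  swap-< (suc c) zero j<c = ≡.refl
  swap-< (suc c) (suc j) (s≤s j<c) = ≡.cong suc (swap-< c j j<c)

  -- m is neither of the swapped columns; in the minor at m they sit at inject₁ c′ and suc c′
  record Away {n} (c : Fin (suc n)) (m : Fin (suc (suc n))) : Set where
    field
      c′ : Fin n
      swap-fixes : swap c m ≡ m
      swap-punchIn : ∀ k → swap c (punchIn m k) ≡ punchIn m (swap c′ k)
      punchIn-inject₁ : punchIn m (inject₁ c′) ≡ inject₁ c
      punchIn-suc : punchIn m (suc c′) ≡ suc c

  data SwapView {n} (c : Fin (suc n)) : Fin (suc (suc n)) → Set where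
    left : SwapView c (inject₁ c)
    right : SwapView c (suc c)
    away : ∀ {m} → Away c m → SwapView c m

  swapView : ∀ {n} (c : Fin (suc n)) m → SwapView c m
  swapView zero zero = left
  swapView zero (suc zero) = right
  swapView {suc n} zero (suc (suc m)) = away record
    { c′ = zero ; swap-fixes = ≡.refl ; swap-punchIn = swap-punchIn-01
    ; punchIn-inject₁ = ≡.refl ; punchIn-suc = ≡.refl }
    where
    swap-punchIn-01 : ∀ k → swap zero (punchIn (suc (suc m)) k) ≡ punchIn (suc (suc m)) (swap zero k)
    swap-punchIn-01 zero = ≡.refl
    swap-punchIn-01 (suc zero) = ≡.refl
    swap-punchIn-01 (suc (suc k)) = ≡.refl
  swapView {suc n} (suc c) zero = away record
    { c′ = c ; swap-fixes = ≡.refl ; swap-punchIn = λ _ → ≡.refl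
    ; punchIn-inject₁ = ≡.refl ; punchIn-suc = ≡.refl }
  swapView {suc n} (suc c) (suc m) with swapView c m
  ... | left = left
  ... | right = right
  ... | away a = away record
    { c′ = suc c′ ; swap-fixes = ≡.cong suc swap-fixes ; swap-punchIn = swap-punchIn-suc′
    ; punchIn-inject₁ = ≡.cong suc punchIn-inject₁ ; punchIn-suc = ≡.cong suc punchIn-suc }
    where
    open Away a
    swap-punchIn-suc′ : ∀ k → swap (suc c) (punchIn (suc m) k) ≡ punchIn (suc m) (swap (suc c′) k)
    swap-punchIn-suc′ zero = ≡.refl
    swap-punchIn-suc′ (suc k) = ≡.cong suc (swap-punchIn k)

  sign-inject₁ : ∀ {n} (c : Fin n) → sign (toℕ (inject₁ c)) ≡ sign (toℕ c)
  sign-inject₁ c = ≡.cong sign (Fin.toℕ-inject₁ c)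

  sum-swap : ∀ {n} (c : Fin n) (f : Fin (suc n) → Carrier) → sum (f ∘ swap c) ≈ sum f
  sum-swap {suc n} zero f = solve 3 (λ a b r → b :+ (a :+ r) := a :+ (b :+ r)) refl _ _ _
  sum-swap {suc n} (suc c) f = +-congˡ (sum-swap c (f ∘ suc))

  swapColumns : ∀ {n} → Fin n → Matrix (suc n) → Matrix (suc n)
  swapColumns c M i j = M i (swap c j)

  det-swap : ∀ {n} (c : Fin n) (M : Matrix (suc n)) → det (suc n) (swapColumns c M) ≈ - det (suc n) M

  laplaceTerm-swap : ∀ {n} (c : Fin (suc n)) (M : Matrix (suc (suc n))) m →
    laplaceTerm (swapColumns c M) m ≈ - laplaceTerm M (swap c m)

  det-swap {suc n} c M = begin
    det (suc (suc n)) (swapColumns c M)      ≡⟨ det-laplace (swapColumns c M) ⟩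
    sum (laplaceTerm (swapColumns c M))      ≈⟨ sum-cong-≋ (laplaceTerm-swap c M) ⟩
    sum (λ m → - laplaceTerm M (swap c m))   ≈⟨ sum-neg (laplaceTerm M ∘ swap c) ⟩
    - sum (laplaceTerm M ∘ swap c)           ≈⟨ -‿cong (sum-swap c (laplaceTerm M)) ⟩
    - sum (laplaceTerm M)                    ≡⟨ ≡.cong -_ (det-laplace M) ⟨
    - det (suc (suc n)) M                    ∎

  laplaceTerm-swap {n} c M m with swapView c m
  ... | left = begin
    sign (toℕ (inject₁ c)) * (M zero (swap c (inject₁ c)) * det (suc n) (minor (swapColumns c M) (inject₁ c)))
      ≈⟨ *-cong (reflexive (sign-inject₁ c))
                (*-cong (entry-≡ M zero (swap-inject₁ c)) (det-cong (λ i k → entry-≡ M (suc i) (swap-punchIn-inject₁ c k)))) ⟩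
    sign (toℕ c) * (M zero (suc c) * det (suc n) (minor M (suc c)))   ≈⟨ flip-sign _ _ ⟩
    - laplaceTerm M (suc c)                                           ≡⟨ ≡.cong (λ l → - laplaceTerm M l) (swap-inject₁ c) ⟨
    - laplaceTerm M (swap c (inject₁ c))                              ∎
    where
    flip-sign : ∀ s y → s * y ≈ - ((- 1# * s) * y)
    flip-sign = solve 2 (λ s y → s :* y := :- ((:- con (+ 1) :* s) :* y)) refl
  ... | right = begin
    (- 1# * sign (toℕ c)) * (M zero (swap c (suc c)) * det (suc n) (minor (swapColumns c M) (suc c)))
      ≈⟨ *-cong (*-congˡ (reflexive (≡.sym (sign-inject₁ c))))
                (*-cong (entry-≡ M zero (swap-suc c)) (det-cong (λ i k → entry-≡ M (suc i) (swap-punchIn-suc c k)))) ⟩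
    (- 1# * sign (toℕ (inject₁ c))) * (M zero (inject₁ c) * det (suc n) (minor M (inject₁ c)))
      ≈⟨ flip-sign _ _ ⟩
    - laplaceTerm M (inject₁ c)                                       ≡⟨ ≡.cong (λ l → - laplaceTerm M l) (swap-suc c) ⟨
    - laplaceTerm M (swap c (suc c))                                  ∎
    where
    flip-sign : ∀ s y → (- 1# * s) * y ≈ - (s * y)
    flip-sign = solve 2 (λ s y → (:- con (+ 1) :* s) :* y := :- (s :* y)) refl
  ... | away a = begin
    sign (toℕ m) * (M zero (swap c m) * det (suc n) (minor (swapColumns c M) m))
      ≈⟨ *-congˡ (*-cong (entry-≡ M zero swap-fixes) (det-cong (λ i k → entry-≡ M (suc i) (swap-punchIn k)))) ⟩
    sign (toℕ m) * (M zero m * det (suc n) (swapColumns c′ (minor M m)))  ≈⟨ *-congˡ (*-congˡ (det-swap c′ (minor M m))) ⟩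
    sign (toℕ m) * (M zero m * - det (suc n) (minor M m))               ≈⟨ solve 3 (λ s x d → s :* (x :* (:- d)) := :- (s :* (x :* d))) refl _ _ _ ⟩
    - laplaceTerm M m                                                   ≡⟨ ≡.cong (λ l → - laplaceTerm M l) swap-fixes ⟨
    - laplaceTerm M (swap c m)                                          ∎
    where open Away a

  sum-cancelling-pair : ∀ {n} (c : Fin n) {f : Fin (suc n) → Carrier} →
    (∀ m → m ≢ inject₁ c → m ≢ suc c → f m ≈ 0#) → f (inject₁ c) + f (suc c) ≈ 0# → sum f ≈ 0#
  sum-cancelling-pair {suc n} zero {f} f≈0 pair = begin
    f zero + (f (suc zero) + sum (λ m → f (suc (suc m))))
      ≈⟨ +-assoc _ _ _ ⟨
    (f zero + f (suc zero)) + sum (λ m → f (suc (suc m)))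
      ≈⟨ +-cong pair (sum-zero (λ m → f (suc (suc m))) (λ m → f≈0 (suc (suc m)) (λ ()) (λ ()))) ⟩
    0# + 0#
      ≈⟨ +-identityˡ 0# ⟩
    0#                                             ∎
  sum-cancelling-pair {suc n} (suc c) {f} f≈0 pair = trans
    (+-cong (f≈0 zero (λ ()) (λ ()))
            (sum-cancelling-pair c (λ m m≢l m≢r → f≈0 (suc m) (m≢l ∘ Fin.suc-injective) (m≢r ∘ Fin.suc-injective)) pair))
    (+-identityˡ 0#)

  det-adjacent-equal : ∀ {n} (c : Fin n) (M : Matrix (suc n)) →
    (∀ i → M i (inject₁ c) ≈ M i (suc c)) → det (suc n) M ≈ 0#
  det-adjacent-equal {suc n} c M cols≈ = begin
    det (suc (suc n)) M  ≡⟨ det-laplace M ⟩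
    sum (laplaceTerm M)  ≈⟨ sum-cancelling-pair c away-zero pair-cancels ⟩
    0#                   ∎
    where
    swap-invariant : ∀ i j → M i (swap c j) ≈ M i j
    swap-invariant i j with swapView c j
    ... | left = trans (entry-≡ M i (swap-inject₁ c)) (sym (cols≈ i))
    ... | right = trans (entry-≡ M i (swap-suc c)) (cols≈ i)
    ... | away a = entry-≡ M i (Away.swap-fixes a)
    away-zero : ∀ m → m ≢ inject₁ c → m ≢ suc c → laplaceTerm M m ≈ 0#
    away-zero m m≢l m≢r with swapView c m
    ... | left = contradiction ≡.refl m≢l
    ... | right = contradiction ≡.refl m≢r
    ... | away a = begin
      sign (toℕ m) * (M zero m * det (suc n) (minor M m))
        ≈⟨ *-congˡ (*-congˡ (det-adjacent-equal c′ (minor M m) minor-cols≈)) ⟩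
      sign (toℕ m) * (M zero m * 0#)
        ≈⟨ trans (*-congˡ (zeroʳ _)) (zeroʳ _) ⟩
      0#                                                   ∎
      where
      open Away a
      minor-cols≈ : ∀ i → minor M m i (inject₁ c′) ≈ minor M m i (suc c′)
      minor-cols≈ i = trans (entry-≡ M (suc i) punchIn-inject₁) (trans (cols≈ (suc i)) (entry-≡ M (suc i) (≡.sym punchIn-suc)))
    same-minor : ∀ i k → minor M (suc c) i k ≈ minor M (inject₁ c) i k
    same-minor i k = trans (entry-≡ M (suc i) (≡.sym (swap-punchIn-inject₁ c k))) (swap-invariant (suc i) _)
    pair-cancels : laplaceTerm M (inject₁ c) + laplaceTerm M (suc c) ≈ 0#
    pair-cancels = begin
      laplaceTerm M (inject₁ c) + (- 1# * sign (toℕ c)) * (M zero (suc c) * det (suc n) (minor M (suc c)))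
        ≈⟨ +-cong (*-congʳ (reflexive (sign-inject₁ c))) (*-congˡ (*-cong (sym (cols≈ zero)) (det-cong same-minor))) ⟩
      sign (toℕ c) * X + (- 1# * sign (toℕ c)) * X
        ≈⟨ solve 2 (λ s x → s :* x :+ (:- con (+ 1) :* s) :* x := con (+ 0)) refl _ _ ⟩
      0# ∎
      where
      X = M zero (inject₁ c) * det (suc n) (minor M (inject₁ c))

  det-equal-columns : ∀ {n} (M : Matrix (suc n)) {j : Fin (suc n)} {k : Fin n} → toℕ j ℕ.≤ toℕ k →
    (∀ i → M i j ≈ M i (suc k)) → det (suc n) M ≈ 0#
  det-equal-columns M {j} {k} j≤k = gap (toℕ k ℕ.∸ toℕ j) M (ℕ.m∸n+n≡m j≤k)
    where
    -- each adjacent swap moves the copy of column j one place to the left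
    gap : ∀ d {n} (M : Matrix (suc n)) {j : Fin (suc n)} {k : Fin n} → d ℕ.+ toℕ j ≡ toℕ k →
      (∀ i → M i j ≈ M i (suc k)) → det (suc n) M ≈ 0#
    gap zero M {j} {k} j≡k cols≈ = det-adjacent-equal k M (λ i → trans (entry-≡ M i j≡inject₁k) (cols≈ i))
      where
      j≡inject₁k : inject₁ k ≡ j
      j≡inject₁k = Fin.toℕ-injective (≡.trans (Fin.toℕ-inject₁ k) (≡.sym j≡k))
    gap (suc d) M {j} {suc k} eq cols≈ = begin
      det _ M             ≈⟨ -‿involutive _ ⟨
      - (- det _ M)       ≈⟨ -‿cong (det-swap (suc k) M) ⟨
      - det _ Mˢ          ≈⟨ -‿cong (gap d Mˢ {j} {inject₁ k} gap-eq colsˢ≈) ⟩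
      - 0#                ≈⟨ -0#≈0# ⟩
      0#                  ∎
      where
      Mˢ = swapColumns (suc k) M
      gap-eq : d ℕ.+ toℕ j ≡ toℕ (inject₁ k)
      gap-eq = ≡.trans (ℕ.suc-injective eq) (≡.sym (Fin.toℕ-inject₁ k))
      colsˢ≈ : ∀ i → Mˢ i j ≈ Mˢ i (suc (inject₁ k))
      colsˢ≈ i = trans (entry-≡ M i (swap-< (suc k) j (ℕ.≤-trans (s≤s (ℕ.m≤n+m (toℕ j) d)) (ℕ.≤-reflexive eq))))
                       (trans (cols≈ i) (entry-≡ M i (≡.sym (swap-inject₁ (suc k)))))

  replaceColumn : ∀ {n} → Matrix n → Fin n → (Fin n → Carrier) → Matrix n
  replaceColumn M k v i = updateAt (M i) k (const (v i))

  det-add-column : ∀ {n} {j : Fin (suc n)} {k : Fin n} → toℕ j ℕ.≤ toℕ k → ∀ a {M M′ : Matrix (suc n)} →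
    (∀ i l → l ≢ suc k → M′ i l ≈ M i l) → (∀ i → M′ i (suc k) ≈ a * M i j + M i (suc k)) →
    det (suc n) M′ ≈ det (suc n) M
  det-add-column {n} {j} {k} j≤k a {M} {M′} M′≈M M′ₖ = begin
    det (suc n) M′                     ≈⟨ det-linear (suc k) a 1# M₁≈M′ (λ i l l≢k → sym (M′≈M i l l≢k)) M′ₖ′ ⟩
    a * det (suc n) M₁ + 1# * det (suc n) M  ≈⟨ +-cong (*-congˡ (det-equal-columns M₁ j≤k M₁-cols≈)) (*-identityˡ _) ⟩
    a * 0# + det (suc n) M             ≈⟨ trans (+-congʳ (zeroʳ a)) (+-identityˡ _) ⟩
    det (suc n) M                      ∎
    where
    M₁ = replaceColumn M (suc k) (λ i → M i j)
    j≢k : j ≢ suc k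
    j≢k j≡k = ℕ.<⇒≢ (s≤s j≤k) (≡.cong toℕ j≡k)
    M₁-at : ∀ i → M₁ i (suc k) ≡ M i j
    M₁-at i = updateAt-updates (suc k) (M i)
    M₁≈M′ : ∀ i l → l ≢ suc k → M₁ i l ≈ M′ i l
    M₁≈M′ i l l≢k = trans (reflexive (updateAt-minimal l (suc k) (M i) l≢k)) (sym (M′≈M i l l≢k))
    M′ₖ′ : ∀ i → M′ i (suc k) ≈ a * M₁ i (suc k) + 1# * M i (suc k)
    M′ₖ′ i = trans (M′ₖ i) (+-cong (*-congˡ (reflexive (≡.sym (M₁-at i)))) (sym (*-identityˡ _)))
    M₁-cols≈ : ∀ i → M₁ i j ≈ M₁ i (suc k)
    M₁-cols≈ i = reflexive (≡.trans (updateAt-minimal j (suc k) (M i) j≢k) (≡.sym (M₁-at i)))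

  det-scale-rows : ∀ {n} (d : Fin n → Carrier) (M : Matrix n) → det n (λ i j → d i * M i j) ≈ prod d * det n M
  det-scale-rows {zero} d M = sym (*-identityˡ 1#)
  det-scale-rows {suc n} d M = begin
    det (suc n) dM                           ≡⟨ det-laplace dM ⟩
    sum (laplaceTerm dM)                     ≈⟨ sum-cong-≋ term-scaled ⟩
    sum (λ m → prod d * laplaceTerm M m)     ≈⟨ *-distribˡ-sum (prod d) (laplaceTerm M) ⟨
    prod d * sum (laplaceTerm M)             ≡⟨ ≡.cong (prod d *_) (det-laplace M) ⟨
    prod d * det (suc n) M                   ∎
    where
    dM : Matrix (suc n)
    dM i j = d i * M i j
    term-scaled : ∀ m → laplaceTerm dM m ≈ prod d * laplaceTerm M m
    term-scaled m = trans (*-congˡ (*-congˡ (det-scale-rows (d ∘ suc) (minor M m))))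
      (solve 5 (λ s d₀ x p D → s :* ((d₀ :* x) :* (p :* D)) := (d₀ :* p) :* (s :* (x :* D))) refl _ _ _ _ _)

  det-unit-first-row : ∀ {n} (M : Matrix (suc n)) → M zero zero ≈ 1# → (∀ j → M zero (suc j) ≈ 0#) →
    det (suc n) M ≈ det n (λ i k → M (suc i) (suc k))
  det-unit-first-row {n} M M₀₀≈1 M₀ⱼ≈0 = begin
    det (suc n) M                                           ≡⟨ det-laplace M ⟩
    laplaceTerm M zero + sum (λ j → laplaceTerm M (suc j))  ≈⟨ +-cong first (sum-zero (λ j → laplaceTerm M (suc j)) rest) ⟩
    det n (minor M zero) + 0#                               ≈⟨ +-identityʳ _ ⟩
    det n (λ i k → M (suc i) (suc k))                       ∎
    where
    first : laplaceTerm M zero ≈ det n (minor M zero)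
    first = trans (*-identityˡ _) (trans (*-congʳ M₀₀≈1) (*-identityˡ _))
    rest : ∀ j → laplaceTerm M (suc j) ≈ 0#
    rest j = trans (*-congˡ (trans (*-congʳ (M₀ⱼ≈0 j)) (zeroˡ _))) (zeroʳ _)

  det-scale-column : ∀ {n} (k : Fin n) a {M M₁ : Matrix n} →
    (∀ i j → j ≢ k → M₁ i j ≈ M i j) → (∀ i → M i k ≈ a * M₁ i k) → det n M ≈ a * det n M₁
  det-scale-column k a M₁≈M Mₖ = trans
    (det-linear k a 0# M₁≈M M₁≈M (λ i → trans (Mₖ i) (solve 2 (λ a x → a :* x := a :* x :+ con (+ 0) :* x) refl _ _)))
    (solve 2 (λ a d → a :* d :+ con (+ 0) :* d := a :* d) refl _ _)

module CompleteHomogeneous {c ℓ'} (R : CommutativeRing c ℓ') where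
  open CommutativeRing R hiding (zero)
  open WithRing R
  open IntegerCoefficients R
  open Summation R
  open import Relation.Binary.Reasoning.Setoid setoid

  -- powConv k f w = Σ_{a ≤ k} w^(k − a) · f a, in Horner form
  powConv : ℕ → (ℕ → Carrier) → Carrier → Carrier
  powConv zero f w = f zero
  powConv (suc k) f w = w * powConv k f w + f (suc k)

  -- h_k(z₀, …, z_{n−1}), split according to the power of z₀
  complete : ∀ {n} → ℕ → (Fin n → Carrier) → Carrier
  complete {zero} zero z = 1#
  complete {zero} (suc k) z = 0#
  complete {suc n} k z = powConv k (λ a → complete a (z ∘ suc)) (z zero)

  powConv-cong : ∀ k {f g : ℕ → Carrier} w → (∀ a → f a ≈ g a) → powConv k f w ≈ powConv k g w
  powConv-cong zero w f≈g = f≈g zero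
  powConv-cong (suc k) w f≈g = +-cong (*-congˡ (powConv-cong k w f≈g)) (f≈g (suc k))

  *-distribˡ-powConv : ∀ k x (f : ℕ → Carrier) w → x * powConv k f w ≈ powConv k (λ a → x * f a) w
  *-distribˡ-powConv zero x f w = refl
  *-distribˡ-powConv (suc k) x f w = begin
    x * (w * powConv k f w + f (suc k))
      ≈⟨ solve 4 (λ x w p q → x :* (w :* p :+ q) := w :* (x :* p) :+ x :* q) refl x w _ _ ⟩
    w * (x * powConv k f w) + x * f (suc k)
      ≈⟨ +-congʳ (*-congˡ (*-distribˡ-powConv k x f w)) ⟩
    w * powConv k (λ a → x * f a) w + x * f (suc k)  ∎

  powConv-geometric : ∀ s z w → (z - w) * powConv s (pow z) w ≈ pow z (suc s) - pow w (suc s)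
  powConv-geometric zero z w = solve 2 (λ z w → (z :- w) :* con (+ 1) := z :* con (+ 1) :- w :* con (+ 1)) refl z w
  powConv-geometric (suc s) z w = begin
    (z - w) * (w * powConv s (pow z) w + pow z (suc s))
      ≈⟨ solve 4 (λ z w g p → (z :- w) :* (w :* g :+ p) := w :* ((z :- w) :* g) :+ (z :- w) :* p) refl z w _ _ ⟩
    w * ((z - w) * powConv s (pow z) w) + (z - w) * pow z (suc s)
      ≈⟨ +-congʳ (*-congˡ (powConv-geometric s z w)) ⟩
    w * (pow z (suc s) - pow w (suc s)) + (z - w) * pow z (suc s)
      ≈⟨ solve 4 (λ z w p q → w :* (p :- q) :+ (z :- w) :* p := z :* p :- w :* q) refl z w _ _ ⟩
    z * pow z (suc s) - w * pow w (suc s) ∎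

  complete-single : ∀ s (z : Fin 1 → Carrier) → complete s z ≈ pow (z zero) s
  complete-single zero z = refl
  complete-single (suc s) z = trans (+-identityʳ _) (*-congˡ (complete-single s z))

  powConv-zero : ∀ k w → powConv k (λ _ → 0#) w ≈ 0#
  powConv-zero zero w = refl
  powConv-zero (suc k) w = trans (+-identityʳ _) (trans (*-congˡ (powConv-zero k w)) (zeroʳ w))

  powConv-if : ∀ b k x (f : ℕ → Carrier) w → (if b then x * powConv k f w else 0#) ≈ powConv k (λ a → if b then x * f a else 0#) w
  powConv-if true k x f w = *-distribˡ-powConv k x f w
  powConv-if false k x f w = sym (powConv-zero k w)

  powConv-sum : ∀ k {N} (g : Fin N → ℕ → Carrier) w → powConv k (λ a → sum (λ q → g q a)) w ≈ sum (λ q → powConv k (g q) w)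
  powConv-sum zero g w = refl
  powConv-sum (suc k) {N} g w = begin
    w * powConv k (λ a → sum (λ q → g q a)) w + sum (λ q → g q (suc k))
      ≈⟨ +-congʳ (*-congˡ (powConv-sum k g w)) ⟩
    w * sum (λ q → powConv k (g q) w) + sum (λ q → g q (suc k))
      ≈⟨ +-congʳ (*-distribˡ-sum w (λ q → powConv k (g q) w)) ⟩
    sum (λ q → w * powConv k (g q) w) + sum (λ q → g q (suc k))
      ≈⟨ ∑-distrib-+ (λ q → w * powConv k (g q) w) (λ q → g q (suc k)) ⟨
    sum (λ q → powConv (suc k) (g q) w)                                  ∎

  powConv-suc : ∀ k f w → powConv (suc k) f w ≈ pow w (suc k) * f zero + powConv k (f ∘ suc) w
  powConv-suc zero f w = +-congʳ (solve 2 (λ w f → w :* f := (w :* con (+ 1)) :* f) refl w (f zero))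
  powConv-suc (suc k) f w = begin
    w * powConv (suc k) f w + f (suc (suc k))                               ≈⟨ +-congʳ (*-congˡ (powConv-suc k f w)) ⟩
    w * (pow w (suc k) * f zero + powConv k (f ∘ suc) w) + f (suc (suc k))
      ≈⟨ solve 5 (λ w p f₀ c f′ → w :* (p :* f₀ :+ c) :+ f′ := (w :* p) :* f₀ :+ (w :* c :+ f′)) refl w _ _ _ _ ⟩
    pow w (suc (suc k)) * f zero + powConv (suc k) (f ∘ suc) w              ∎

  complete-zero : ∀ {n} (z : Fin n → Carrier) → complete 0 z ≈ 1#
  complete-zero {zero} z = refl
  complete-zero {suc n} z = complete-zero (z ∘ suc)

if-true : ∀ {a} {A : Set a} {b} {x y : A} → T b → (if b then x else y) ≡ x
if-true {b = true} _ = ≡.refl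

if-false : ∀ {a} {A : Set a} {b} {x y : A} → ¬ T b → (if b then x else y) ≡ y
if-false {b = true} ¬b = contradiction tt ¬b
if-false {b = false} _ = ≡.refl

module InversePowerVandermonde {c ℓ'} (R : CommutativeRing c ℓ') where
  open CommutativeRing R hiding (zero)
  open WithRing R
  open IntegerCoefficients R
  open Summation R
  open Determinant R
  open CompleteHomogeneous R
  open import Relation.Binary.Reasoning.Setoid setoid

  -- lemMatrix ℓ r w winv is withLastColumn ℓ w (winv ^ r)
  withLastColumn : (ℓ : ℕ) → (w v : Fin ℓ → Carrier) → Matrix ℓ
  withLastColumn ℓ w v i j = if toℕ j ≡ᵇ ℓ ∸ 1 then v i else pow (w i) (toℕ j)

  withLastColumn-last : ∀ {ℓ} w v i {j} → toℕ j ≡ ℓ ∸ 1 → withLastColumn ℓ w v i j ≡ v i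
  withLastColumn-last {ℓ} w v i {j} j≡ = if-true (ℕ.≡⇒≡ᵇ (toℕ j) (ℓ ∸ 1) j≡)

  withLastColumn-power : ∀ {ℓ} w v i {j} → toℕ j ≢ ℓ ∸ 1 → withLastColumn ℓ w v i j ≡ pow (w i) (toℕ j)
  withLastColumn-power {ℓ} w v i {j} j≢ = if-false (j≢ ∘ ℕ.≡ᵇ⇒≡ (toℕ j) (ℓ ∸ 1))

  Δ : ∀ {n} → (Fin n → Carrier) → Carrier
  Δ x = prod (λ i → prod (λ j → if toℕ j <ᵇ toℕ i then x i - x j else 1#))

  Δ-suc : ∀ {n} (x : Fin (suc n) → Carrier) → Δ x ≈ prod (λ i → x (suc i) - x zero) * Δ (x ∘ suc)
  Δ-suc {n} x = trans (*-congʳ (prod-one {suc n} _ (λ _ → refl)))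
    (trans (*-identityˡ _) (∏-distrib-* (λ i → x (suc i) - x zero)
                                        (λ i → prod (λ j → if toℕ j <ᵇ toℕ i then x (suc i) - x (suc j) else 1#))))

  subtractPrevious : ∀ {n} → ℕ → Carrier → Matrix (suc n) → Matrix (suc n)
  subtractPrevious b a M i zero = M i zero
  subtractPrevious b a M i (suc j) = if toℕ j <ᵇ b then M i (suc j) - a * M i (inject₁ j) else M i (suc j)

  subtractFromNext : ∀ {n} → Fin n → Carrier → Matrix (suc n) → Matrix (suc n)
  subtractFromNext k a M = replaceColumn M (suc k) (λ i → M i (suc k) - a * M i (inject₁ k))

  subtractFromNext-at : ∀ {n} (k : Fin n) a M i → subtractFromNext k a M i (suc k) ≡ M i (suc k) - a * M i (inject₁ k)
  subtractFromNext-at k a M i = updateAt-updates (suc k) (M i)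

  subtractFromNext-off : ∀ {n} (k : Fin n) a M i l → l ≢ suc k → subtractFromNext k a M i l ≈ M i l
  subtractFromNext-off k a M i l l≢k = reflexive (updateAt-minimal l (suc k) (M i) l≢k)

  det-subtractFromNext : ∀ {n} (k : Fin n) a M → det (suc n) (subtractFromNext k a M) ≈ det (suc n) M
  det-subtractFromNext k a M = det-add-column (ℕ.≤-reflexive (Fin.toℕ-inject₁ k)) (- a) (subtractFromNext-off k a M)
    (λ i → trans (reflexive (subtractFromNext-at k a M i)) (solve 3 (λ a p q → q :- a :* p := (:- a) :* p :+ q) refl a _ _))

  subtractPrevious-suc : ∀ {n} b a (M : Matrix (suc n)) (b<n : b ℕ.< n) →
    ∀ i j → subtractPrevious (suc b) a M i j ≈ subtractPrevious b a (subtractFromNext (fromℕ< b<n) a M) i j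
  subtractPrevious-suc b a M b<n i zero = sym (subtractFromNext-off (fromℕ< b<n) a M i zero (λ ()))
  subtractPrevious-suc b a M b<n i (suc j) with ℕ.<-cmp (toℕ j) b
  ... | tri< j<b _ _ = begin
    subtractPrevious (suc b) a M i (suc j)   ≡⟨ if-true (ℕ.<⇒<ᵇ (ℕ.m<n⇒m<1+n j<b)) ⟩
    M i (suc j) - a * M i (inject₁ j)        ≈⟨ +-cong (off (suc j) sj≢k) (-‿cong (*-congˡ (off (inject₁ j) ij≢k))) ⟨
    M′ i (suc j) - a * M′ i (inject₁ j)      ≡⟨ if-true (ℕ.<⇒<ᵇ j<b) ⟨
    subtractPrevious b a M′ i (suc j)        ∎
    where
    M′ = subtractFromNext (fromℕ< b<n) a M
    off = subtractFromNext-off (fromℕ< b<n) a M i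
    sj≢k : suc j ≢ suc (fromℕ< b<n)
    sj≢k eq = ℕ.<⇒≢ j<b (≡.trans (≡.cong toℕ (Fin.suc-injective eq)) (Fin.toℕ-fromℕ< b<n))
    ij≢k : inject₁ j ≢ suc (fromℕ< b<n)
    ij≢k eq = ℕ.<⇒≢ (ℕ.m<n⇒m<1+n j<b)
      (≡.trans (≡.sym (Fin.toℕ-inject₁ j)) (≡.trans (≡.cong toℕ eq) (≡.cong suc (Fin.toℕ-fromℕ< b<n))))
  ... | tri≈ _ j≡b _ = begin
    subtractPrevious (suc b) a M i (suc j)   ≡⟨ if-true (ℕ.<⇒<ᵇ (ℕ.≤-reflexive (≡.cong suc j≡b))) ⟩
    M i (suc j) - a * M i (inject₁ j)        ≡⟨ ≡.cong (λ l → M i (suc l) - a * M i (inject₁ l)) j≡k ⟩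
    M i (suc k) - a * M i (inject₁ k)        ≡⟨ subtractFromNext-at k a M i ⟨
    M′ i (suc k)                             ≡⟨ ≡.cong (λ l → M′ i (suc l)) j≡k ⟨
    M′ i (suc j)                             ≡⟨ if-false (ℕ.<-irrefl j≡b ∘ ℕ.<ᵇ⇒< (toℕ j) b) ⟨
    subtractPrevious b a M′ i (suc j)        ∎
    where
    k = fromℕ< b<n
    M′ = subtractFromNext k a M
    j≡k : j ≡ k
    j≡k = Fin.toℕ-injective (≡.trans j≡b (≡.sym (Fin.toℕ-fromℕ< b<n)))
  ... | tri> _ _ b<j = begin
    subtractPrevious (suc b) a M i (suc j)   ≡⟨ if-false (ℕ.<⇒≱ b<j ∘ ℕ.≤-pred ∘ ℕ.<ᵇ⇒< (toℕ j) (suc b)) ⟩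
    M i (suc j)                              ≈⟨ subtractFromNext-off (fromℕ< b<n) a M i (suc j) sj≢k ⟨
    M′ i (suc j)                             ≡⟨ if-false (ℕ.<⇒≯ b<j ∘ ℕ.<ᵇ⇒< (toℕ j) b) ⟨
    subtractPrevious b a M′ i (suc j)        ∎
    where
    M′ = subtractFromNext (fromℕ< b<n) a M
    sj≢k : suc j ≢ suc (fromℕ< b<n)
    sj≢k eq = ℕ.>⇒≢ b<j (≡.trans (≡.cong toℕ (Fin.suc-injective eq)) (Fin.toℕ-fromℕ< b<n))

  det-subtractPrevious : ∀ {n} b a (M : Matrix (suc n)) → b ℕ.≤ n →
    det (suc n) (subtractPrevious b a M) ≈ det (suc n) M
  det-subtractPrevious zero a M _ = det-cong unchanged
    where
    unchanged : ∀ i j → subtractPrevious zero a M i j ≈ M i j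
    unchanged i zero = refl
    unchanged i (suc j) = refl
  det-subtractPrevious {n} (suc b) a M b<n = begin
    det (suc n) (subtractPrevious (suc b) a M)  ≈⟨ det-cong (subtractPrevious-suc b a M b<n) ⟩
    det (suc n) (subtractPrevious b a M′)       ≈⟨ det-subtractPrevious b a M′ (ℕ.<⇒≤ b<n) ⟩
    det (suc n) M′                              ≈⟨ det-subtractFromNext (fromℕ< b<n) a M ⟩
    det (suc n) M                               ∎
    where
    M′ = subtractFromNext (fromℕ< b<n) a M

  vandermonde≈Δ : ∀ {n} (x : Fin n → Carrier) → vandermonde n x ≈ Δ x
  vandermonde≈Δ {n} x = begin
    vandermonde n x                                       ≈⟨ prodL-concatMap _ (allFin n) ⟩
    prodL (map (λ i → prodL (concatMap (factors i) (allFin n))) (allFin n))  ≈⟨ prodL-map-cong (allFin n) row≈ ⟩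
    prodL (map row (allFin n))                            ≡⟨ prodL-allFin row ⟩
    Δ x                                                   ∎
    where
    factors : Fin n → Fin n → List Carrier
    factors i j = if toℕ j <ᵇ toℕ i then (x i - x j) ∷ [] else []
    row : Fin n → Carrier
    row i = prod (λ j → if toℕ j <ᵇ toℕ i then x i - x j else 1#)
    singleton-if : ∀ b a → prodL (if b then a ∷ [] else []) ≈ (if b then a else 1#)
    singleton-if true a = *-identityʳ a
    singleton-if false a = refl
    row≈ : ∀ i → prodL (concatMap (factors i) (allFin n)) ≈ row i
    row≈ i = trans (prodL-concatMap (factors i) (allFin n))
      (trans (prodL-map-cong (allFin n) (λ j → singleton-if (toℕ j <ᵇ toℕ i) (x i - x j)))
             (reflexive (prodL-allFin (λ j → if toℕ j <ᵇ toℕ i then x i - x j else 1#))))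

  det-powConv-column : ∀ {n} (k : Fin n) s w {M : Matrix n} {Ms : ℕ → Matrix n} →
    (∀ a i j → j ≢ k → Ms a i j ≈ M i j) → (∀ i → M i k ≈ powConv s (λ a → Ms a i k) w) →
    det n M ≈ powConv s (λ a → det n (Ms a)) w
  det-powConv-column k zero w {M} {Ms} Ms≈M Mₖ = det-cong entries
    where
    entries : ∀ i j → M i j ≈ Ms zero i j
    entries i j with j Fin.≟ k
    ... | yes ≡.refl = Mₖ i
    ... | no j≢k = sym (Ms≈M zero i j j≢k)
  det-powConv-column {n} k (suc s) w {M} {Ms} Ms≈M Mₖ = begin
    det n M
      ≈⟨ det-linear k w 1# M₁≈M (Ms≈M (suc s)) Mₖ′ ⟩
    w * det n M₁ + 1# * det n (Ms (suc s))
      ≈⟨ +-cong (*-congˡ (det-powConv-column k s w Ms≈M₁ (reflexive ∘ M₁-at))) (*-identityˡ _) ⟩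
    powConv (suc s) (λ a → det n (Ms a)) w    ∎
    where
    M₁ = replaceColumn M k (λ i → powConv s (λ a → Ms a i k) w)
    M₁-at : ∀ i → M₁ i k ≡ powConv s (λ a → Ms a i k) w
    M₁-at i = updateAt-updates k (M i)
    M₁≈M : ∀ i j → j ≢ k → M₁ i j ≈ M i j
    M₁≈M i j j≢k = reflexive (updateAt-minimal j k (M i) j≢k)
    Ms≈M₁ : ∀ a i j → j ≢ k → Ms a i j ≈ M₁ i j
    Ms≈M₁ a i j j≢k = trans (Ms≈M a i j j≢k) (sym (M₁≈M i j j≢k))
    Mₖ′ : ∀ i → M i k ≈ w * M₁ i k + 1# * Ms (suc s) i k
    Mₖ′ i = trans (Mₖ i) (sym (+-cong (*-congˡ (reflexive (M₁-at i))) (*-identityˡ _)))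

  -- since xᵢzᵢ = 1 = x₀z₀, zᵢ − z₀ = (xᵢ − x₀)(−z₀zᵢ)
  inverse-power-difference : ∀ {xᵢ zᵢ x₀ z₀} → xᵢ * zᵢ ≈ 1# → x₀ * z₀ ≈ 1# → ∀ s →
    pow zᵢ (suc s) - pow z₀ (suc s) ≈ (xᵢ - x₀) * (- z₀ * powConv s (λ a → pow zᵢ (suc a)) z₀)
  inverse-power-difference {xᵢ} {zᵢ} {x₀} {z₀} xz≈1 xz₀≈1 s = sym (begin
    (xᵢ - x₀) * (- z₀ * powConv s (λ a → pow zᵢ (suc a)) z₀)
      ≈⟨ *-congˡ (*-congˡ (*-distribˡ-powConv s zᵢ (pow zᵢ) z₀)) ⟨
    (xᵢ - x₀) * (- z₀ * (zᵢ * G))                ≈⟨ expand ⟩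
    (x₀ * z₀) * (zᵢ * G) - (xᵢ * zᵢ) * (z₀ * G)  ≈⟨ +-cong (*-congʳ xz₀≈1) (-‿cong (*-congʳ xz≈1)) ⟩
    1# * (zᵢ * G) - 1# * (z₀ * G)                ≈⟨ solve 3 (λ u v g → con (+ 1) :* (u :* g) :- con (+ 1) :* (v :* g) := (u :- v) :* g) refl zᵢ z₀ G ⟩
    (zᵢ - z₀) * G                                ≈⟨ powConv-geometric s zᵢ z₀ ⟩
    pow zᵢ (suc s) - pow z₀ (suc s)              ∎)
    where
    G = powConv s (pow zᵢ) z₀
    expand : (xᵢ - x₀) * (- z₀ * (zᵢ * G)) ≈ (x₀ * z₀) * (zᵢ * G) - (xᵢ * zᵢ) * (z₀ * G)
    expand = solve 5 (λ xi zi x0 z0 g → (xi :- x0) :* (:- z0 :* (zi :* g)) := (x0 :* z0) :* (zi :* g) :- (xi :* zi) :* (z0 :* g))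
                     refl xᵢ zᵢ x₀ z₀ G

  -- M₁: clear the top of the last column with column 0; M₂: then Cⱼ₊₁ − x₀Cⱼ on the power columns.
  -- The first row of M₂ is (1, 0, …, 0) and row i + 1 of its minor is (xᵢ₊₁ − x₀) times row i of Q.
  module Reduction (n s : ℕ) (x z : Fin (suc (suc n)) → Carrier) (xz≈1 : ∀ i → x i * z i ≈ 1#) where
    x₀ = x zero
    z₀ = z zero

    last : Fin (suc n)
    last = fromℕ n

    M : Matrix (suc (suc n))
    M = lemMatrix (suc (suc n)) (suc s) x z

    M₁ : Matrix (suc (suc n))
    M₁ = replaceColumn M (suc last) (λ i → - pow z₀ (suc s) * M i zero + M i (suc last))

    M₂ : Matrix (suc (suc n))
    M₂ = subtractPrevious n x₀ M₁

    zˢ : Fin (suc (suc n)) → Carrier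
    zˢ i = pow (z i) (suc s)

    q : Fin (suc n) → Carrier
    q i = - z₀ * powConv s (λ a → pow (z (suc i)) (suc a)) z₀

    Q : Matrix (suc n)
    Q = withLastColumn (suc n) (x ∘ suc) q

    ≡last : ∀ {k : Fin (suc n)} → toℕ k ≡ n → k ≡ last
    ≡last k≡n = Fin.toℕ-injective (≡.trans k≡n (≡.sym (Fin.toℕ-fromℕ n)))

    <last : ∀ {k : Fin (suc n)} → toℕ k ≢ n → toℕ k ℕ.< n
    <last {k} k≢n = ℕ.≤∧≢⇒< (Fin.toℕ≤pred[n] k) k≢n

    M₁-power : ∀ i j → toℕ j ≢ suc n → M₁ i j ≡ pow (x i) (toℕ j)
    M₁-power i j j≢ = ≡.trans (updateAt-minimal j (suc last) (M i) j≢last) (withLastColumn-power x zˢ i j≢)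
      where
      j≢last : j ≢ suc last
      j≢last j≡ = j≢ (≡.trans (≡.cong toℕ j≡) (≡.cong suc (Fin.toℕ-fromℕ n)))

    M₁-last : ∀ i → M₁ i (suc last) ≈ pow (z i) (suc s) - pow z₀ (suc s)
    M₁-last i = begin
      M₁ i (suc last)
        ≡⟨ updateAt-updates (suc last) (M i) ⟩
      - pow z₀ (suc s) * M i zero + M i (suc last)
        ≡⟨ ≡.cong₂ (λ a b → - pow z₀ (suc s) * a + b) (withLastColumn-power x zˢ i {zero} λ ())
                   (withLastColumn-last x zˢ i (≡.cong suc (Fin.toℕ-fromℕ n))) ⟩
      - pow z₀ (suc s) * 1# + pow (z i) (suc s)
        ≈⟨ solve 2 (λ y p → (:- y) :* con (+ 1) :+ p := p :- y) refl _ _ ⟩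
      pow (z i) (suc s) - pow z₀ (suc s)                    ∎

    M₂-power : ∀ i k → toℕ k ℕ.< n → M₂ i (suc k) ≈ (x i - x₀) * pow (x i) (toℕ k)
    M₂-power i k k<n = begin
      M₂ i (suc k)
        ≡⟨ if-true (ℕ.<⇒<ᵇ k<n) ⟩
      M₁ i (suc k) - x₀ * M₁ i (inject₁ k)
        ≡⟨ ≡.cong₂ (λ a b → a - x₀ * b) (M₁-power i (suc k) (ℕ.<⇒≢ k<n ∘ ℕ.suc-injective))
                                                              (≡.trans (M₁-power i (inject₁ k) inject₁k≢) (≡.cong (pow (x i)) (Fin.toℕ-inject₁ k))) ⟩
      x i * pow (x i) (toℕ k) - x₀ * pow (x i) (toℕ k)
        ≈⟨ solve 3 (λ xi x0 p → xi :* p :- x0 :* p := (xi :- x0) :* p) refl _ _ _ ⟩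
      (x i - x₀) * pow (x i) (toℕ k)                     ∎
      where
      inject₁k≢ : toℕ (inject₁ k) ≢ suc n
      inject₁k≢ eq = ℕ.<⇒≢ (ℕ.m<n⇒m<1+n k<n) (≡.trans (≡.sym (Fin.toℕ-inject₁ k)) eq)

    M₂-last : ∀ i → M₂ i (suc last) ≈ pow (z i) (suc s) - pow z₀ (suc s)
    M₂-last i = trans (reflexive (if-false (ℕ.<-irrefl (Fin.toℕ-fromℕ n) ∘ ℕ.<ᵇ⇒< (toℕ last) n))) (M₁-last i)

    first-row : ∀ k → M₂ zero (suc k) ≈ 0#
    first-row k with toℕ k ℕ.≟ n
    ... | yes k≡n = trans (reflexive (≡.cong (λ l → M₂ zero (suc l)) (≡last k≡n))) (trans (M₂-last zero) (-‿inverseʳ _))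
    ... | no k≢n = trans (M₂-power zero k (<last k≢n)) (trans (*-congʳ (-‿inverseʳ x₀)) (zeroˡ _))

    minor-factor : ∀ i k → M₂ (suc i) (suc k) ≈ (x (suc i) - x₀) * Q i k
    minor-factor i k with toℕ k ℕ.≟ n
    ... | yes k≡n = begin
      M₂ (suc i) (suc k)
        ≡⟨ ≡.cong (λ l → M₂ (suc i) (suc l)) (≡last k≡n) ⟩
      M₂ (suc i) (suc last)
        ≈⟨ M₂-last (suc i) ⟩
      pow (z (suc i)) (suc s) - pow z₀ (suc s)
        ≈⟨ inverse-power-difference (xz≈1 (suc i)) (xz≈1 zero) s ⟩
      (x (suc i) - x₀) * (- z₀ * powConv s (λ a → pow (z (suc i)) (suc a)) z₀)
        ≡⟨ ≡.cong ((x (suc i) - x₀) *_) (withLastColumn-last (x ∘ suc) q i k≡n) ⟨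
      (x (suc i) - x₀) * Q i k                      ∎
    ... | no k≢n = trans (M₂-power (suc i) k (<last k≢n)) (*-congˡ (reflexive (≡.sym (withLastColumn-power (x ∘ suc) q i k≢n))))

    det-reduce : det (suc (suc n)) M ≈ prod (λ i → x (suc i) - x₀) * det (suc n) Q
    det-reduce = begin
      det (suc (suc n)) M
        ≈⟨ det-add-column z≤n (- pow z₀ (suc s)) M₁≈M (λ i → reflexive (updateAt-updates (suc last) (M i))) ⟨
      det (suc (suc n)) M₁
        ≈⟨ det-subtractPrevious n x₀ M₁ (ℕ.n≤1+n n) ⟨
      det (suc (suc n)) M₂
        ≈⟨ det-unit-first-row M₂ (reflexive (M₁-power zero zero λ ())) first-row ⟩
      det (suc n) (λ i k → M₂ (suc i) (suc k))
        ≈⟨ det-cong minor-factor ⟩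
      det (suc n) (λ i k → (x (suc i) - x₀) * Q i k)
        ≈⟨ det-scale-rows (λ i → x (suc i) - x₀) Q ⟩
      prod (λ i → x (suc i) - x₀) * det (suc n) Q         ∎
      where
      M₁≈M : ∀ i l → l ≢ suc last → M₁ i l ≈ M i l
      M₁≈M i l l≢ = reflexive (updateAt-minimal l (suc last) (M i) l≢)

    det-Q : det (suc n) Q ≈ - z₀ * powConv s (λ a → det (suc n) (lemMatrix (suc n) (suc a) (x ∘ suc) (z ∘ suc))) z₀
    det-Q = begin
      det (suc n) Q   ≈⟨ det-scale-column last (- z₀) Q′≈Q Qₗ ⟩
      - z₀ * det (suc n) Q′  ≈⟨ *-congˡ (det-powConv-column last s z₀ Pₐ≈Q′ Q′ₗ) ⟩
      - z₀ * powConv s (λ a → det (suc n) (lemMatrix (suc n) (suc a) (x ∘ suc) (z ∘ suc))) z₀ ∎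
      where
      zᵃ : ℕ → Fin (suc n) → Carrier
      zᵃ a i = pow (z (suc i)) (suc a)
      Q′ = replaceColumn Q last (λ i → powConv s (λ a → pow (z (suc i)) (suc a)) z₀)
      Q′≈Q : ∀ i j → j ≢ last → Q′ i j ≈ Q i j
      Q′≈Q i j j≢ = reflexive (updateAt-minimal j last (Q i) j≢)
      Qₗ : ∀ i → Q i last ≈ - z₀ * Q′ i last
      Qₗ i = reflexive (≡.trans (withLastColumn-last (x ∘ suc) q i (Fin.toℕ-fromℕ n))
                                (≡.cong (- z₀ *_) (≡.sym (updateAt-updates last (Q i)))))
      Q′ₗ : ∀ i → Q′ i last ≈ powConv s (λ a → lemMatrix (suc n) (suc a) (x ∘ suc) (z ∘ suc) i last) z₀
      Q′ₗ i = trans (reflexive (updateAt-updates last (Q i)))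
        (powConv-cong s z₀ (λ a → reflexive (≡.sym (withLastColumn-last (x ∘ suc) (zᵃ a) i (Fin.toℕ-fromℕ n)))))
      Pₐ≈Q′ : ∀ a i j → j ≢ last → lemMatrix (suc n) (suc a) (x ∘ suc) (z ∘ suc) i j ≈ Q′ i j
      Pₐ≈Q′ a i j j≢ = reflexive (≡.trans (withLastColumn-power (x ∘ suc) (zᵃ a) i (j≢ ∘ ≡last))
        (≡.sym (≡.trans (updateAt-minimal j last (Q i) j≢) (withLastColumn-power (x ∘ suc) q i (j≢ ∘ ≡last)))))

  det-lemMatrix : ∀ n s (x z : Fin (suc n) → Carrier) → (∀ i → x i * z i ≈ 1#) →
    det (suc n) (lemMatrix (suc n) (suc s) x z) ≈ sign n * (Δ x * (prod z * complete s z))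
  det-lemMatrix zero s x z _ = begin
    1# * (z₀ * pow z₀ s * 1#) + 0#                  ≈⟨ normalise z₀ (pow z₀ s) ⟩
    1# * (1# * 1# * 1# * (z₀ * 1# * pow z₀ s))      ≈⟨ *-congˡ (*-congˡ (*-congˡ (complete-single s z))) ⟨
    sign 0 * (Δ x * (prod z * complete s z))        ∎
    where
    z₀ = z zero
    normalise : ∀ u p → 1# * (u * p * 1#) + 0# ≈ 1# * (1# * 1# * 1# * (u * 1# * p))
    normalise = solve 2 (λ u p → con (+ 1) :* (u :* p :* con (+ 1)) :+ con (+ 0)
                               := con (+ 1) :* (con (+ 1) :* con (+ 1) :* con (+ 1) :* (u :* con (+ 1) :* p))) refl
  det-lemMatrix (suc n) s x z xz≈1 = begin
    det (suc (suc n)) M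
      ≈⟨ det-reduce ⟩
    Pd * det (suc n) Q
      ≈⟨ *-congˡ det-Q ⟩
    Pd * (- z₀ * powConv s (λ a → det (suc n) (lemMatrix (suc n) (suc a) x′ z′)) z₀)
      ≈⟨ *-congˡ (*-congˡ (powConv-cong s z₀ (λ a → trans (det-lemMatrix n a x′ z′ (xz≈1 ∘ suc)) (reassociate _ _ _ _)))) ⟩
    Pd * (- z₀ * powConv s (λ a → D * complete a z′) z₀)
      ≈⟨ *-congˡ (*-congˡ (*-distribˡ-powConv s D _ z₀)) ⟨
    Pd * (- z₀ * (D * complete s z))
      ≈⟨ regroup Pd z₀ (sign n) (Δ x′) (prod z′) _ ⟩
    sign (suc n) * ((Pd * Δ x′) * (prod z * complete s z))
      ≈⟨ *-congˡ (*-congʳ (Δ-suc x)) ⟨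
    sign (suc n) * (Δ x * (prod z * complete s z))            ∎
    where
    open Reduction n s x z xz≈1
    x′ = x ∘ suc
    z′ = z ∘ suc
    Pd = prod (λ i → x (suc i) - x₀)
    D = sign n * Δ x′ * prod z′
    reassociate : ∀ σ V E K → σ * (V * (E * K)) ≈ σ * V * E * K
    reassociate = solve 4 (λ σ V E K → σ :* (V :* (E :* K)) := σ :* V :* E :* K) refl
    regroup : ∀ P u σ V E K → P * (- u * (σ * V * E * K)) ≈ (- 1# * σ) * ((P * V) * ((u * E) * K))
    regroup = solve 6 (λ P u σ V E K → P :* (:- u :* (σ :* V :* E :* K)) := (:- con (+ 1) :* σ) :* ((P :* V) :* ((u :* E) :* K))) refl

module Tableaux where
  open ∨-∧-Solver using () renaming (solve to solveᵇ; _:*_ to _:∧_; _:=_ to _:≡_)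

  prependColumn : ∀ {a} {A : Set a} → List A → List (List A) → List (List A)
  prependColumn (a ∷ as) (r ∷ rs) = (a ∷ r) ∷ prependColumn as rs
  prependColumn _ _ = []

  headAtLeast : ∀ {N} → ℕ → List (Fin N) → Bool
  headAtLeast lo [] = true
  headAtLeast lo (a ∷ _) = lo ≤ᵇ toℕ a

  increasing : ∀ {N} → List (Fin N) → Bool
  increasing (a ∷ b ∷ xs) = (toℕ a <ᵇ toℕ b) ∧ increasing (b ∷ xs)
  increasing _ = true

  firstColumnAtLeast : ∀ {N} → List (Fin N) → List (List (Fin N)) → Bool
  firstColumnAtLeast (a ∷ as) (r ∷ rs) = headAtLeast (toℕ a) r ∧ firstColumnAtLeast as rs
  firstColumnAtLeast _ _ = true

  infix 4 _≤ᶜ_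
  _≤ᶜ_ : ∀ {N} → List (Fin N) → List (Fin N) → Bool
  (a ∷ as) ≤ᶜ (b ∷ bs) = (toℕ a ≤ᵇ toℕ b) ∧ (as ≤ᶜ bs)
  _ ≤ᶜ _ = true

  weakInc-∷ : ∀ {N} (a : Fin N) r → weakInc (a ∷ r) ≡ headAtLeast (toℕ a) r ∧ weakInc r
  weakInc-∷ a [] = ≡.refl
  weakInc-∷ a (b ∷ r) = ≡.refl

  increasing-∷ : ∀ {N} (a : Fin N) r → increasing (a ∷ r) ≡ headAtLeast (suc (toℕ a)) r ∧ increasing r
  increasing-∷ a [] = ≡.refl
  increasing-∷ a (b ∷ r) = ≡.refl

  isSSYT-prependColumn : ∀ {N} (c : List (Fin N)) T → length c ≡ length T → 1 ℕ.≤ length c →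
    isSSYT (prependColumn c T) ≡ increasing c ∧ (firstColumnAtLeast c T ∧ isSSYT T)
  isSSYT-prependColumn (a ∷ []) (r ∷ []) _ _ = ≡.trans (weakInc-∷ a r) (≡.cong (_∧ weakInc r) (≡.sym (Bool.∧-identityʳ _)))
  isSSYT-prependColumn (a ∷ b ∷ c) (r ∷ r′ ∷ T) eq _ = ≡.trans
    (≡.cong₂ (λ x y → x ∧ (((toℕ a <ᵇ toℕ b) ∧ colStrict r r′) ∧ y)) (weakInc-∷ a r)
             (isSSYT-prependColumn (b ∷ c) (r′ ∷ T) (ℕ.suc-injective eq) (s≤s z≤n)))
    (shuffle (headAtLeast (toℕ a) r) (weakInc r) (toℕ a <ᵇ toℕ b) (colStrict r r′)
             (increasing (b ∷ c)) (firstColumnAtLeast (b ∷ c) (r′ ∷ T)) (isSSYT (r′ ∷ T)))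
    where
    shuffle : ∀ p q s t u v w → (p ∧ q) ∧ ((s ∧ t) ∧ (u ∧ (v ∧ w))) ≡ (s ∧ u) ∧ ((p ∧ v) ∧ (q ∧ (t ∧ w)))
    shuffle = solveᵇ 7 (λ p q s t u v w → (p :∧ q) :∧ ((s :∧ t) :∧ (u :∧ (v :∧ w)))
                                       :≡ (s :∧ u) :∧ ((p :∧ v) :∧ (q :∧ (t :∧ w)))) ≡.refl

  firstColumnAtLeast-prependColumn : ∀ {N} (b c : List (Fin N)) T → length c ≡ length T →
    firstColumnAtLeast b (prependColumn c T) ≡ (b ≤ᶜ c)
  firstColumnAtLeast-prependColumn [] c T _ = ≡.refl
  firstColumnAtLeast-prependColumn (a ∷ b) [] [] _ = ≡.refl
  firstColumnAtLeast-prependColumn (a ∷ b) (x ∷ c) (r ∷ T) eq =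
    ≡.cong ((toℕ a ≤ᵇ toℕ x) ∧_) (firstColumnAtLeast-prependColumn b c T (ℕ.suc-injective eq))

  firstColumnAtLeast-empty : ∀ {N} (b : List (Fin N)) m → firstColumnAtLeast b (replicate m []) ≡ true
  firstColumnAtLeast-empty [] m = ≡.refl
  firstColumnAtLeast-empty (a ∷ b) zero = ≡.refl
  firstColumnAtLeast-empty (a ∷ b) (suc m) = firstColumnAtLeast-empty b m

  isSSYT-empty : ∀ {N} m → isSSYT {N} (replicate m []) ≡ true
  isSSYT-empty zero = ≡.refl
  isSSYT-empty (suc zero) = ≡.refl
  isSSYT-empty (suc (suc m)) = isSSYT-empty (suc m)

  firstColumnAtLeast-zeros : ∀ {N} m (T : List (List (Fin (suc N)))) → firstColumnAtLeast (replicate m zero) T ≡ true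
  firstColumnAtLeast-zeros zero T = ≡.refl
  firstColumnAtLeast-zeros (suc m) [] = ≡.refl
  firstColumnAtLeast-zeros (suc m) ([] ∷ T) = firstColumnAtLeast-zeros m T
  firstColumnAtLeast-zeros (suc m) ((b ∷ r) ∷ T) = firstColumnAtLeast-zeros m T

  zeros-≤ᶜ : ∀ {N} m (c : List (Fin (suc N))) → (replicate m zero ≤ᶜ c) ≡ true
  zeros-≤ᶜ zero c = ≡.refl
  zeros-≤ᶜ (suc m) [] = ≡.refl
  zeros-≤ᶜ (suc m) (b ∷ c) = zeros-≤ᶜ m c

  ≤ᵇ-suc : ∀ a b → (suc a ≤ᵇ suc b) ≡ (a ≤ᵇ b)
  ≤ᵇ-suc zero b = ≡.refl
  ≤ᵇ-suc (suc a) b = ≡.refl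

  ≤ᵇ-true : ∀ {m n} → m ℕ.≤ n → (m ≤ᵇ n) ≡ true
  ≤ᵇ-true m≤n = Equivalence.to Bool.T-≡ (ℕ.≤⇒≤ᵇ m≤n)

  ≤ᶜ-refl : ∀ {N} (xs : List (Fin N)) → (xs ≤ᶜ xs) ≡ true
  ≤ᶜ-refl [] = ≡.refl
  ≤ᶜ-refl (x ∷ xs) = ≡.cong₂ _∧_ (≤ᵇ-true (ℕ.≤-refl {toℕ x})) (≤ᶜ-refl xs)

  ≤ᶜ-suc : ∀ {N n} (f g : Fin n → Fin N) →
    (tabulate (λ k → suc (f k)) ≤ᶜ tabulate (λ k → suc (g k))) ≡ (tabulate f ≤ᶜ tabulate g)
  ≤ᶜ-suc {n = zero} f g = ≡.refl
  ≤ᶜ-suc {n = suc n} f g = ≡.cong₂ _∧_ (≤ᵇ-suc (toℕ (f zero)) (toℕ (g zero))) (≤ᶜ-suc (λ k → f (suc k)) (λ k → g (suc k)))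

  complement : ∀ {n} → Fin (suc n) → List (Fin (suc n))
  complement q = tabulate (punchIn q)

  complement-≤ᶜ : ∀ {n} (q₀ q : Fin (suc n)) → (complement q₀ ≤ᶜ complement q) ≡ (toℕ q ≤ᵇ toℕ q₀)
  complement-≤ᶜ {n} zero zero = ≤ᶜ-refl (complement {n} zero)
  complement-≤ᶜ {suc n} zero (suc q) = ≡.refl
  complement-≤ᶜ {suc n} (suc q₀) zero = ≡.trans (≤ᶜ-suc (punchIn q₀) suc) (complement-≤ᶜ q₀ zero)
  complement-≤ᶜ {suc n} (suc q₀) (suc q) =
    ≡.trans (≤ᶜ-suc (punchIn q₀) (punchIn q)) (≡.trans (complement-≤ᶜ q₀ q) (≡.sym (≤ᵇ-suc (toℕ q) (toℕ q₀))))

module RectangularSchur {c ℓ'} (R : CommutativeRing c ℓ') where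
  open CommutativeRing R hiding (zero)
  open WithRing R
  open IntegerCoefficients R
  open Summation R
  open Powers R
  open CompleteHomogeneous R
  open Tableaux
  open import Algebra.Properties.CommutativeSemigroup *-commutativeSemigroup using (interchange)
  open import Relation.Binary.Reasoning.Setoid setoid

  if-cong : ∀ b {x y : Carrier} → x ≈ y → (if b then x else 0#) ≈ (if b then y else 0#)
  if-cong true x≈y = x≈y
  if-cong false x≈y = refl

  sumOver-lists-suc : ∀ {N} k (G : List (Fin N) → Carrier) →
    sumOver (lists N (suc k)) G ≈ sum (λ a → sumOver (lists N k) (λ r → G (a ∷ r)))
  sumOver-lists-suc {N} k G = begin
    sumOver (lists N (suc k)) G
      ≈⟨ sumOver-concatMap (λ a → map (a ∷_) (lists N k)) (allFin N) G ⟩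
    sumOver (allFin N) (λ a → sumOver (map (a ∷_) (lists N k)) G)
      ≡⟨ ≡.cong sumL (List.map-cong (λ a → sumOver-map (a ∷_) (lists N k) G) (allFin N)) ⟩
    sumOver (allFin N) (λ a → sumOver (lists N k) (λ r → G (a ∷ r)))
      ≡⟨ sumL-allFin (λ a → sumOver (lists N k) (λ r → G (a ∷ r))) ⟩
    sum (λ a → sumOver (lists N k) (λ r → G (a ∷ r)))                ∎

  sumOver-fillings-∷ : ∀ {N} k ks (G : List (List (Fin N)) → Carrier) →
    sumOver (fillings N (k ∷ ks)) G ≈ sumOver (lists N k) (λ r → sumOver (fillings N ks) (λ T → G (r ∷ T)))
  sumOver-fillings-∷ {N} k ks G = trans (sumOver-concatMap (λ r → map (r ∷_) (fillings N ks)) (lists N k) G)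
    (reflexive (≡.cong sumL (List.map-cong (λ r → sumOver-map (r ∷_) (fillings N ks) G) (lists N k))))

  sumOver-fillings-columns : ∀ {N} m k (F : List (List (Fin N)) → Carrier) →
    sumOver (fillings N (replicate m (suc k))) F
      ≈ sumOver (lists N m) (λ c → sumOver (fillings N (replicate m k)) (λ T → F (prependColumn c T)))
  sumOver-fillings-columns zero k F = sym (+-identityʳ _)
  sumOver-fillings-columns {N} (suc m) k F = begin
    sumOver (fillings N (replicate (suc m) (suc k))) F
      ≈⟨ sumOver-fillings-∷ (suc k) (replicate m (suc k)) F ⟩
    sumOver (lists N (suc k)) (λ r → sumOver (fillings N (replicate m (suc k))) (λ T → F (r ∷ T)))
      ≈⟨ sumOver-lists-suc k (λ r → sumOver (fillings N (replicate m (suc k))) (λ T → F (r ∷ T))) ⟩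
    sum (λ a → sumOver (lists N k) (λ r → sumOver (fillings N (replicate m (suc k))) (λ T → F ((a ∷ r) ∷ T))))
      ≈⟨ sum-cong-≋ (λ a → sumOver-cong (lists N k) (λ r → sumOver-fillings-columns m k (λ T → F ((a ∷ r) ∷ T)))) ⟩
    sum (λ a → sumOver (lists N k) (λ r → sumOver (lists N m) (λ c → G a r c)))
      ≈⟨ sum-cong-≋ (λ a → sumOver-comm (lists N k) (lists N m) (G a)) ⟩
    sum (λ a → sumOver (lists N m) (λ c → sumOver (lists N k) (λ r → G a r c)))
      ≈⟨ sum-cong-≋ (λ a → sumOver-cong (lists N m) (λ c → sumOver-fillings-∷ k (replicate m k) (H (a ∷ c)))) ⟨
    sum (λ a → sumOver (lists N m) (λ c → sumOver (fillings N (replicate (suc m) k)) (H (a ∷ c))))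
      ≈⟨ sumOver-lists-suc m (λ c → sumOver (fillings N (replicate (suc m) k)) (H c)) ⟨
    sumOver (lists N (suc m)) (λ c → sumOver (fillings N (replicate (suc m) k)) (H c)) ∎
    where
    H : List (Fin N) → List (List (Fin N)) → Carrier
    H c T = F (prependColumn c T)
    G : Fin N → List (Fin N) → List (Fin N) → Carrier
    G a r c = sumOver (fillings N (replicate m k)) (λ T → F ((a ∷ r) ∷ prependColumn c T))

  sumOver-lists-cong : ∀ {N} m {f g : List (Fin N) → Carrier} → (∀ c → length c ≡ m → f c ≈ g c) →
    sumOver (lists N m) f ≈ sumOver (lists N m) g
  sumOver-lists-cong zero f≈g = +-congʳ (f≈g [] ≡.refl)
  sumOver-lists-cong {N} (suc m) {f} {g} f≈g = begin
    sumOver (lists N (suc m)) f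
      ≈⟨ sumOver-lists-suc m f ⟩
    sum (λ a → sumOver (lists N m) (λ c → f (a ∷ c)))
      ≈⟨ sum-cong-≋ (λ a → sumOver-lists-cong m (λ c eq → f≈g (a ∷ c) (≡.cong suc eq))) ⟩
    sum (λ a → sumOver (lists N m) (λ c → g (a ∷ c)))
      ≈⟨ sumOver-lists-suc m g ⟨
    sumOver (lists N (suc m)) g                          ∎

  sumOver-fillings-cong : ∀ {N} m k {f g : List (List (Fin N)) → Carrier} → (∀ T → length T ≡ m → f T ≈ g T) →
    sumOver (fillings N (replicate m k)) f ≈ sumOver (fillings N (replicate m k)) g
  sumOver-fillings-cong zero k f≈g = +-congʳ (f≈g [] ≡.refl)
  sumOver-fillings-cong {N} (suc m) k {f} {g} f≈g = begin
    sumOver (fillings N (replicate (suc m) k)) f   ≈⟨ sumOver-fillings-∷ k (replicate m k) f ⟩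
    sumOver (lists N k) (λ r → sumOver (fillings N (replicate m k)) (λ T → f (r ∷ T)))
      ≈⟨ sumOver-cong (lists N k) (λ r → sumOver-fillings-cong m k (λ T eq → f≈g (r ∷ T) (≡.cong suc eq))) ⟩
    sumOver (lists N k) (λ r → sumOver (fillings N (replicate m k)) (λ T → g (r ∷ T)))
      ≈⟨ sumOver-fillings-∷ k (replicate m k) g ⟨
    sumOver (fillings N (replicate (suc m) k)) g   ∎

  sumOver-fillings-empty : ∀ {N} m (f : List (List (Fin N)) → Carrier) →
    sumOver (fillings N (replicate m 0)) f ≈ f (replicate m [])
  sumOver-fillings-empty zero f = +-identityʳ _
  sumOver-fillings-empty (suc m) f = trans (sumOver-fillings-∷ 0 (replicate m 0) f)
    (trans (+-identityʳ _) (sumOver-fillings-empty m (λ T → f ([] ∷ T))))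

  if-∧-factor : ∀ p q r {X Y Z} → Y ≈ X * Z →
    (if p ∧ (q ∧ r) then Y else 0#) ≈ (if q ∧ p then X * (if r then Z else 0#) else 0#)
  if-∧-factor true true true Y≈XZ = Y≈XZ
  if-∧-factor true true false _ = sym (zeroʳ _)
  if-∧-factor true false r _ = refl
  if-∧-factor false true r _ = refl
  if-∧-factor false false r _ = refl

  module Weighted {N} (w : Fin N → Carrier) where
    columnWeight : List (Fin N) → Carrier
    columnWeight c = prodL (map w c)

    weight : List (List (Fin N)) → Carrier
    weight T = prodL (map w (concat T))

    columnWeight-++ : ∀ xs ys → columnWeight (xs ++ ys) ≈ columnWeight xs * columnWeight ys
    columnWeight-++ xs ys = trans (reflexive (≡.cong prodL (List.map-++ w xs ys))) (prodL-++ (map w xs) (map w ys))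

    weight-prependColumn : ∀ c T → length c ≡ length T → weight (prependColumn c T) ≈ columnWeight c * weight T
    weight-prependColumn [] [] _ = sym (*-identityˡ _)
    weight-prependColumn (a ∷ c) (r ∷ T) eq = begin
      w a * columnWeight (r ++ concat (prependColumn c T))
        ≈⟨ *-congˡ (columnWeight-++ r _) ⟩
      w a * (columnWeight r * weight (prependColumn c T))
        ≈⟨ *-congˡ (*-congˡ (weight-prependColumn c T (ℕ.suc-injective eq))) ⟩
      w a * (columnWeight r * (columnWeight c * weight T))
        ≈⟨ solve 4 (λ a r c t → a :* (r :* (c :* t)) := (a :* c) :* (r :* t)) refl _ _ _ _ ⟩
      (w a * columnWeight c) * (columnWeight r * weight T)
        ≈⟨ *-congˡ (columnWeight-++ r (concat T)) ⟨
      (w a * columnWeight c) * weight (r ∷ T)               ∎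

    weight-empty : ∀ m → weight (replicate m []) ≈ 1#
    weight-empty zero = refl
    weight-empty (suc m) = weight-empty m

    boundedSchur : ℕ → ℕ → List (Fin N) → Carrier
    boundedSchur m k b =
      sumOver (fillings N (replicate m k)) (λ T → if firstColumnAtLeast b T ∧ isSSYT T then weight T else 0#)

    boundedSchur-zero : ∀ m b → boundedSchur m 0 b ≈ 1#
    boundedSchur-zero m b = begin
      boundedSchur m 0 b  ≈⟨ sumOver-fillings-empty m _ ⟩
      (if firstColumnAtLeast b (replicate m []) ∧ isSSYT (replicate m []) then weight (replicate m []) else 0#)
        ≡⟨ ≡.cong₂ (λ x y → if x ∧ y then weight (replicate m []) else 0#) (firstColumnAtLeast-empty b m) (isSSYT-empty m) ⟩
      weight (replicate m [])  ≈⟨ weight-empty m ⟩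
      1#                       ∎

    boundedSchur-suc : ∀ m k b → boundedSchur (suc m) (suc k) b ≈
      sumOver (lists N (suc m)) (λ c → if increasing c ∧ (b ≤ᶜ c) then columnWeight c * boundedSchur (suc m) k c else 0#)
    boundedSchur-suc m k b = trans (sumOver-fillings-columns (suc m) k (summand b)) (sumOver-lists-cong (suc m) column)
      where
      Tableaux = fillings N (replicate (suc m) k)
      summand : List (Fin N) → List (List (Fin N)) → Carrier
      summand c T = if firstColumnAtLeast c T ∧ isSSYT T then weight T else 0#
      split : ∀ c → length c ≡ suc m → ∀ T → length T ≡ suc m →
        summand b (prependColumn c T) ≈ (if increasing c ∧ (b ≤ᶜ c) then columnWeight c * summand c T else 0#)
      split c lc T lT
        rewrite firstColumnAtLeast-prependColumn b c T (≡.trans lc (≡.sym lT))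
              | isSSYT-prependColumn c T (≡.trans lc (≡.sym lT)) (≡.subst (1 ℕ.≤_) (≡.sym lc) (s≤s z≤n))
        = if-∧-factor (b ≤ᶜ c) (increasing c) (firstColumnAtLeast c T ∧ isSSYT T) (weight-prependColumn c T (≡.trans lc (≡.sym lT)))
      column : ∀ c → length c ≡ suc m →
        sumOver Tableaux (λ T → summand b (prependColumn c T))
          ≈ (if increasing c ∧ (b ≤ᶜ c) then columnWeight c * boundedSchur (suc m) k c else 0#)
      column c lc = begin
        sumOver Tableaux (λ T → summand b (prependColumn c T))
          ≈⟨ sumOver-fillings-cong (suc m) k (split c lc) ⟩
        sumOver Tableaux (λ T → if increasing c ∧ (b ≤ᶜ c) then columnWeight c * summand c T else 0#)
          ≈⟨ sumOver-if Tableaux (increasing c ∧ (b ≤ᶜ c)) _ ⟩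
        (if increasing c ∧ (b ≤ᶜ c) then sumOver Tableaux (λ T → columnWeight c * summand c T) else 0#)
          ≈⟨ if-cong (increasing c ∧ (b ≤ᶜ c)) (*-distribˡ-sumOver (columnWeight c) Tableaux (summand c)) ⟨
        (if increasing c ∧ (b ≤ᶜ c) then columnWeight c * boundedSchur (suc m) k c else 0#) ∎

  schur-boundedSchur : ∀ {n} (w : Fin (suc n) → Carrier) m k →
    schur (suc n) (replicate m k) w ≈ Weighted.boundedSchur w m k (replicate m zero)
  schur-boundedSchur {n} w m k = sumOver-cong (fillings (suc n) (replicate m k))
    (λ T → reflexive (≡.cong (λ b → if b ∧ isSSYT T then Weighted.weight w T else 0#) (≡.sym (firstColumnAtLeast-zeros m T))))

  increasingSum : (N m lo : ℕ) → (List (Fin N) → Carrier) → Carrier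
  increasingSum N m lo g = sumOver (lists N m) (λ c → if headAtLeast lo c ∧ increasing c then g c else 0#)

  increasingSum-∷ : ∀ N m lo g → increasingSum N (suc m) lo g ≈
    sum (λ a → if lo ≤ᵇ toℕ a then increasingSum N m (suc (toℕ a)) (λ r → g (a ∷ r)) else 0#)
  increasingSum-∷ N m lo g =
    trans (sumOver-lists-suc m (λ c → if headAtLeast lo c ∧ increasing c then g c else 0#)) (sum-cong-≋ first-entry)
    where
    first-entry : ∀ a → sumOver (lists N m) (λ r → if (lo ≤ᵇ toℕ a) ∧ increasing (a ∷ r) then g (a ∷ r) else 0#)
      ≈ (if lo ≤ᵇ toℕ a then increasingSum N m (suc (toℕ a)) (λ r → g (a ∷ r)) else 0#)
    first-entry a with lo ≤ᵇ toℕ a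
    ... | true = sumOver-cong (lists N m) (λ r → reflexive (≡.cong (λ b → if b then g (a ∷ r) else 0#) (increasing-∷ a r)))
    ... | false = sumOver-zero (lists N m) (λ _ → refl)

  increasingSum-shift : ∀ N m lo g → increasingSum (suc N) m (suc lo) g ≈ increasingSum N m lo (g ∘ map suc)
  increasingSum-shift N zero lo g = refl
  increasingSum-shift N (suc m) lo g = begin
    increasingSum (suc N) (suc m) (suc lo) g
      ≈⟨ increasingSum-∷ (suc N) m (suc lo) g ⟩
    0# + sum (λ a → if suc lo ≤ᵇ suc (toℕ a) then increasingSum (suc N) m (suc (suc (toℕ a))) (λ r → g (suc a ∷ r)) else 0#)
      ≈⟨ trans (+-identityˡ _) (sum-cong-≋ shifted) ⟩
    sum (λ a → if lo ≤ᵇ toℕ a then increasingSum N m (suc (toℕ a)) (λ r → g (suc a ∷ map suc r)) else 0#)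
      ≈⟨ increasingSum-∷ N m lo (g ∘ map suc) ⟨
    increasingSum N (suc m) lo (g ∘ map suc) ∎
    where
    shifted : ∀ a → (if suc lo ≤ᵇ suc (toℕ a) then increasingSum (suc N) m (suc (suc (toℕ a))) (λ r → g (suc a ∷ r)) else 0#)
      ≈ (if lo ≤ᵇ toℕ a then increasingSum N m (suc (toℕ a)) (λ r → g (suc a ∷ map suc r)) else 0#)
    shifted a rewrite ≤ᵇ-suc lo (toℕ a) = if-cong (lo ≤ᵇ toℕ a) (increasingSum-shift N m (suc (toℕ a)) (λ r → g (suc a ∷ r)))

  increasingSum-split : ∀ N m g → increasingSum (suc N) (suc m) 0 g ≈
    increasingSum N m 0 (λ r → g (zero ∷ map suc r)) + increasingSum N (suc m) 0 (g ∘ map suc)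
  increasingSum-split N m g = begin
    increasingSum (suc N) (suc m) 0 g
      ≈⟨ increasingSum-∷ (suc N) m 0 g ⟩
    increasingSum (suc N) m 1 (λ r → g (zero ∷ r)) + sum (λ a → increasingSum (suc N) m (suc (suc (toℕ a))) (λ r → g (suc a ∷ r)))
      ≈⟨ +-cong (increasingSum-shift N m 0 (λ r → g (zero ∷ r)))
                (sum-cong-≋ (λ a → increasingSum-shift N m (suc (toℕ a)) (λ r → g (suc a ∷ r)))) ⟩
    increasingSum N m 0 (λ r → g (zero ∷ map suc r)) + sum (λ a → increasingSum N m (suc (toℕ a)) (λ r → g (suc a ∷ map suc r)))
      ≈⟨ +-congˡ (increasingSum-∷ N m 0 (g ∘ map suc)) ⟨
    increasingSum N m 0 (λ r → g (zero ∷ map suc r)) + increasingSum N (suc m) 0 (g ∘ map suc) ∎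

  increasingSum-tooLong : ∀ N m g → N ℕ.< m → increasingSum N m 0 g ≈ 0#
  increasingSum-tooLong zero (suc m) g _ = increasingSum-∷ 0 m 0 g
  increasingSum-tooLong (suc N) (suc m) g (s≤s N<m) = begin
    increasingSum (suc N) (suc m) 0 g
      ≈⟨ increasingSum-split N m g ⟩
    _ + _
      ≈⟨ +-cong (increasingSum-tooLong N m _ N<m) (increasingSum-tooLong N (suc m) _ (ℕ.m<n⇒m<1+n N<m)) ⟩
    0# + 0#
      ≈⟨ +-identityˡ 0# ⟩
    0#                                 ∎

  increasingSum-full : ∀ N g → increasingSum N N 0 g ≈ g (allFin N)
  increasingSum-full zero g = +-identityʳ _
  increasingSum-full (suc N) g = begin
    increasingSum (suc N) (suc N) 0 g
      ≈⟨ increasingSum-split N N g ⟩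
    _ + increasingSum N (suc N) 0 (g ∘ map suc)
      ≈⟨ +-cong (increasingSum-full N _) (increasingSum-tooLong N (suc N) _ (ℕ.n<1+n N)) ⟩
    g (zero ∷ map suc (allFin N)) + 0#
      ≈⟨ +-identityʳ _ ⟩
    g (zero ∷ map suc (allFin N))
      ≡⟨ ≡.cong (λ l → g (zero ∷ l)) (List.map-tabulate id suc) ⟩
    g (allFin (suc N))                                 ∎

  increasingSum-complements : ∀ n g → increasingSum (suc n) n 0 g ≈ sum (λ q → g (complement q))
  increasingSum-complements zero g = refl
  increasingSum-complements (suc n) g = begin
    increasingSum (suc (suc n)) (suc n) 0 g
      ≈⟨ increasingSum-split (suc n) n g ⟩
    increasingSum (suc n) n 0 (λ r → g (zero ∷ map suc r)) + increasingSum (suc n) (suc n) 0 (g ∘ map suc)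
      ≈⟨ +-cong (increasingSum-complements n _) (increasingSum-full (suc n) _) ⟩
    sum (λ q → g (zero ∷ map suc (complement q))) + g (map suc (allFin (suc n)))
      ≈⟨ +-cong (sum-cong-≋ (λ q → reflexive (≡.cong (λ l → g (zero ∷ l)) (List.map-tabulate (punchIn q) suc))))
                (reflexive (≡.cong g (List.map-tabulate id suc))) ⟩
    sum (λ q → g (complement (suc q))) + g (complement zero)
      ≈⟨ +-comm _ _ ⟩
    sum (λ q → g (complement q)) ∎

  -- completeUpTo z k q = h_k(z₀, …, z_q), split according to the largest index in a monomial
  completeUpTo : ∀ {N} → (Fin N → Carrier) → ℕ → Fin N → Carrier
  completeUpTo z zero q₀ = 1#
  completeUpTo z (suc k) q₀ = sum (λ q → if toℕ q ≤ᵇ toℕ q₀ then z q * completeUpTo z k q else 0#)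

  completeUpTo-zero : ∀ {N} (z : Fin (suc N) → Carrier) k → completeUpTo z k zero ≈ pow (z zero) k
  completeUpTo-zero z zero = refl
  completeUpTo-zero {N} z (suc k) = trans (+-cong (*-congˡ (completeUpTo-zero z k)) (sum-zero {N} _ (λ _ → refl))) (+-identityʳ _)

  completeUpTo-suc : ∀ {N} (z : Fin (suc N) → Carrier) k (q₀ : Fin N) →
    completeUpTo z k (suc q₀) ≈ powConv k (λ a → completeUpTo (z ∘ suc) a q₀) (z zero)
  completeUpTo-suc z zero q₀ = refl
  completeUpTo-suc {N} z (suc k) q₀ = begin
    z zero * completeUpTo z k zero + sum (λ q → if suc (toℕ q) ≤ᵇ suc (toℕ q₀) then z (suc q) * completeUpTo z k (suc q) else 0#)
      ≈⟨ +-cong (*-congˡ (completeUpTo-zero z k)) (sum-cong-≋ later) ⟩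
    z zero * pow (z zero) k + sum (λ q → powConv k (g q) (z zero))
      ≈⟨ +-congˡ (powConv-sum k g (z zero)) ⟨
    z zero * pow (z zero) k + powConv k (λ a → completeUpTo (z ∘ suc) (suc a) q₀) (z zero)
      ≈⟨ +-congʳ (*-identityʳ _) ⟨
    pow (z zero) (suc k) * 1# + powConv k (λ a → completeUpTo (z ∘ suc) (suc a) q₀) (z zero)
      ≈⟨ powConv-suc k (λ a → completeUpTo (z ∘ suc) a q₀) (z zero) ⟨
    powConv (suc k) (λ a → completeUpTo (z ∘ suc) a q₀) (z zero) ∎
    where
    g : Fin N → ℕ → Carrier
    g q a = if toℕ q ≤ᵇ toℕ q₀ then z (suc q) * completeUpTo (z ∘ suc) a q else 0#
    later : ∀ q → (if suc (toℕ q) ≤ᵇ suc (toℕ q₀) then z (suc q) * completeUpTo z k (suc q) else 0#) ≈ powConv k (g q) (z zero)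
    later q rewrite ≤ᵇ-suc (toℕ q) (toℕ q₀) = trans (if-cong (toℕ q ≤ᵇ toℕ q₀) (*-congˡ (completeUpTo-suc z k q)))
      (powConv-if (toℕ q ≤ᵇ toℕ q₀) k (z (suc q)) _ (z zero))

  completeUpTo-last : ∀ N (z : Fin (suc N) → Carrier) k → completeUpTo z k (fromℕ N) ≈ complete k z
  completeUpTo-last zero z k = trans (completeUpTo-zero z k) (sym (complete-single k z))
  completeUpTo-last (suc N) z k =
    trans (completeUpTo-suc z k (fromℕ N)) (powConv-cong k (z zero) (λ a → completeUpTo-last N (z ∘ suc) a))

  columnWeight-complement : ∀ {n} (w z : Fin (suc n) → Carrier) → (∀ i → w i * z i ≈ 1#) →
    ∀ q → Weighted.columnWeight w (complement q) * prod z ≈ z q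
  columnWeight-complement {n} w z wz≈1 q = begin
    prodL (map w (tabulate (punchIn q))) * prod z
      ≡⟨ ≡.cong (λ l → prodL l * prod z) (List.map-tabulate (punchIn q) w) ⟩
    prodL (tabulate (w ∘ punchIn q)) * prod z
      ≡⟨ ≡.cong (_* prod z) (foldr-tabulate _*_ 1# (w ∘ punchIn q)) ⟩
    prod (w ∘ punchIn q) * prod z
      ≈⟨ *-congˡ (prod-remove {i = q} z) ⟩
    prod (w ∘ punchIn q) * (z q * prod (z ∘ punchIn q))
      ≈⟨ solve 3 (λ a b c → a :* (b :* c) := b :* (a :* c)) refl _ _ _ ⟩
    z q * (prod (w ∘ punchIn q) * prod (z ∘ punchIn q))
      ≈⟨ *-congˡ (∏-distrib-* (w ∘ punchIn q) (z ∘ punchIn q)) ⟨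
    z q * prod (λ k → w (punchIn q k) * z (punchIn q k))
      ≈⟨ *-congˡ (prod-one _ (wz≈1 ∘ punchIn q)) ⟩
    z q * 1#
      ≈⟨ *-identityʳ _ ⟩
    z q                                                           ∎

  module Rectangle (n : ℕ) (w z : Fin (suc (suc n)) → Carrier) (wz≈1 : ∀ i → w i * z i ≈ 1#) where
    open Weighted w
    E = prod z

    boundedSchur-complements : ∀ k b → boundedSchur (suc n) (suc k) b ≈
      sum (λ q → if b ≤ᶜ complement q then columnWeight (complement q) * boundedSchur (suc n) k (complement q) else 0#)
    boundedSchur-complements k b = begin
      boundedSchur (suc n) (suc k) b
        ≈⟨ boundedSchur-suc n k b ⟩
      sumOver (lists _ (suc n)) (λ c → if increasing c ∧ (b ≤ᶜ c) then term c else 0#)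
        ≈⟨ sumOver-cong (lists _ (suc n)) (reflexive ∘ unconstrained-head) ⟩
      increasingSum _ (suc n) 0 (λ c → if b ≤ᶜ c then term c else 0#)
        ≈⟨ increasingSum-complements (suc n) _ ⟩
      sum (λ q → if b ≤ᶜ complement q then term (complement q) else 0#)            ∎
      where
      term : List (Fin (suc (suc n))) → Carrier
      term c = columnWeight c * boundedSchur (suc n) k c
      unconstrained-head : ∀ c → (if increasing c ∧ (b ≤ᶜ c) then term c else 0#)
        ≡ (if headAtLeast 0 c ∧ increasing c then (if b ≤ᶜ c then term c else 0#) else 0#)
      unconstrained-head [] = ≡.refl
      unconstrained-head (a ∷ c) = Bool.if-∧ (increasing (a ∷ c))

    weighted-step : ∀ k b → boundedSchur (suc n) (suc k) b * pow E (suc k) ≈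
      sum (λ q → if b ≤ᶜ complement q then z q * (boundedSchur (suc n) k (complement q) * pow E k) else 0#)
    weighted-step k b = begin
      boundedSchur (suc n) (suc k) b * pow E (suc k)
        ≈⟨ *-congʳ (boundedSchur-complements k b) ⟩
      sum (λ q → if b ≤ᶜ complement q then columnWeight (complement q) * Φ q else 0#) * (E * pow E k)
        ≈⟨ *-distribʳ-sum (E * pow E k) (λ q → if b ≤ᶜ complement q then columnWeight (complement q) * Φ q else 0#) ⟩
      sum (λ q → (if b ≤ᶜ complement q then columnWeight (complement q) * Φ q else 0#) * (E * pow E k))
        ≈⟨ sum-cong-≋ (λ q → regroup (b ≤ᶜ complement q) q) ⟩
      sum (λ q → if b ≤ᶜ complement q then z q * (Φ q * pow E k) else 0#) ∎
      where
      Φ : Fin (suc (suc n)) → Carrier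
      Φ q = boundedSchur (suc n) k (complement q)
      regroup : ∀ t q → (if t then columnWeight (complement q) * Φ q else 0#) * (E * pow E k)
                        ≈ (if t then z q * (Φ q * pow E k) else 0#)
      regroup true q = trans (interchange _ _ _ _) (*-congʳ (columnWeight-complement w z wz≈1 q))
      regroup false q = zeroˡ _

    boundedSchur-complement : ∀ k q₀ → boundedSchur (suc n) k (complement q₀) * pow E k ≈ completeUpTo z k q₀
    boundedSchur-complement zero q₀ = trans (*-identityʳ _) (boundedSchur-zero (suc n) (complement q₀))
    boundedSchur-complement (suc k) q₀ = trans (weighted-step k (complement q₀)) (sum-cong-≋ step)
      where
      step : ∀ q → (if complement q₀ ≤ᶜ complement q then z q * (boundedSchur (suc n) k (complement q) * pow E k) else 0#)
        ≈ (if toℕ q ≤ᵇ toℕ q₀ then z q * completeUpTo z k q else 0#)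
      step q rewrite complement-≤ᶜ q₀ q = if-cong (toℕ q ≤ᵇ toℕ q₀) (*-congˡ (boundedSchur-complement k q))

    schur-rectangle-suc : ∀ k → schur (suc (suc n)) (replicate (suc n) (suc k)) w * pow E (suc k) ≈ complete (suc k) z
    schur-rectangle-suc k = begin
      schur (suc (suc n)) (replicate (suc n) (suc k)) w * pow E (suc k)
        ≈⟨ *-congʳ (schur-boundedSchur w (suc n) (suc k)) ⟩
      boundedSchur (suc n) (suc k) (replicate (suc n) zero) * pow E (suc k)
        ≈⟨ weighted-step k (replicate (suc n) zero) ⟩
      sum (λ q → if replicate (suc n) zero ≤ᶜ complement q then z q * (boundedSchur (suc n) k (complement q) * pow E k) else 0#)
        ≈⟨ sum-cong-≋ step ⟩
      completeUpTo z (suc k) (fromℕ (suc n))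
        ≈⟨ completeUpTo-last (suc n) z (suc k) ⟩
      complete (suc k) z ∎
      where
      step : ∀ q → (if replicate (suc n) zero ≤ᶜ complement q then z q * (boundedSchur (suc n) k (complement q) * pow E k) else 0#)
        ≈ (if toℕ q ≤ᵇ toℕ (fromℕ (suc n)) then z q * completeUpTo z k q else 0#)
      step q rewrite zeros-≤ᶜ (suc n) (complement q)
                   | ≤ᵇ-true (Fin.≤fromℕ q) = *-congˡ (boundedSchur-complement k q)

  schur-rectangle : ∀ n s (w z : Fin (suc n) → Carrier) → (∀ i → w i * z i ≈ 1#) →
    schur (suc n) (replicate n s) w * pow (prod z) s ≈ complete s z
  schur-rectangle zero s w z _ = begin
    (1# + 0#) * pow (z zero * 1#) s   ≈⟨ *-cong (+-identityʳ 1#) (pow-cong (*-identityʳ _) s) ⟩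
    1# * pow (z zero) s                ≈⟨ *-identityˡ _ ⟩
    pow (z zero) s                     ≈⟨ complete-single s z ⟨
    complete s z                       ∎
  schur-rectangle (suc n) zero w z _ = begin
    schur (suc (suc n)) (replicate (suc n) 0) w * 1#
      ≈⟨ *-identityʳ _ ⟩
    schur (suc (suc n)) (replicate (suc n) 0) w
      ≈⟨ schur-boundedSchur w (suc n) 0 ⟩
    Weighted.boundedSchur w (suc n) 0 (replicate (suc n) zero)
      ≈⟨ Weighted.boundedSchur-zero w (suc n) (replicate (suc n) zero) ⟩
    1#
      ≈⟨ complete-zero z ⟨
    complete 0 z                                          ∎
  schur-rectangle (suc n) (suc k) w z wz≈1 = Rectangle.schur-rectangle-suc n w z wz≈1 k

open import Data.Nat using (_*_)

lemma3p4 : ∀ {c ℓ'} (R : CommutativeRing c ℓ') →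
    let open CommutativeRing R renaming (_*_ to _·_) in
    let open WithRing R in
    (ℓ r : ℕ) → 1 ≤ ℓ → 1 ≤ r →
    (w winv : Fin ℓ → Carrier) → (∀ i → w i · winv i ≈ 1#) →
    det ℓ (lemMatrix ℓ r w winv)
      ≈ ((sign ((ℓ ∸ 1) * (ℓ ∸ 1)) · schur ℓ (replicate (ℓ ∸ 1) (r ∸ 1)) w) · vandermonde ℓ w)
        · pow (elem ℓ winv) r
lemma3p4 R (suc n) (suc s) (s≤s z≤n) (s≤s z≤n) w winv w·winv≈1 = begin
  det (suc n) (lemMatrix (suc n) (suc s) w winv)
    ≈⟨ det-lemMatrix n s w winv w·winv≈1 ⟩
  sign n · (Δ w · (E · complete s winv))
    ≈⟨ ·-congˡ (·-congˡ (·-congˡ (schur-rectangle n s w winv w·winv≈1))) ⟨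
  sign n · (Δ w · (E · (S · pow E s)))
    ≈⟨ solve 5 (λ σ V E S P → σ :* (V :* (E :* (S :* P))) := ((σ :* S) :* V) :* (E :* P)) refl (sign n) (Δ w) E S _ ⟩
  ((sign n · S) · Δ w) · pow E (suc s)
    ≈⟨ ·-cong (·-cong (·-congʳ (sign-square n)) (vandermonde≈Δ w))
              (reflexive (≡.cong (λ e → pow e (suc s)) (prodL-allFin winv))) ⟨
  ((sign (n * n) · S) · vandermonde (suc n) w) · pow (elem (suc n) winv) (suc s) ∎
  where
  open CommutativeRing R hiding (zero) renaming (_*_ to _·_; *-cong to ·-cong; *-congˡ to ·-congˡ; *-congʳ to ·-congʳ)
  open WithRing R
  open IntegerCoefficients R
  open Summation R
  open CompleteHomogeneous R
  open InversePowerVandermonde R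
  open RectangularSchur R
  open Powers R
  open import Relation.Binary.Reasoning.Setoid setoid
  E = prod winv
  S = schur (suc n) (replicate n s) w
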